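{- Let $w\in\widetilde{C}_n/C_n$ with window $w_i=c_iN+\sigma_i$ ($N=2n+2$, $c_i\in\mathbb{Z}$, $\sigma\in C_n$), and let $\lambda\in L_n$ correspond to $w$ under $w\mapsto(2c_1-e_1,\dots,2nc_n-e_n)$, $(e_1,\dots,e_n)=\Psi(\sigma)$. Then \[ \alpha(w)=\sum_{i=1}^nc_i-\mathsf{neg}(w)=\sum_{i=1}^n\Big\lceil\frac{\lambda_i}{i}\Big\rceil-\sum_{i=1}^n\Big\lceil\frac{\lambda_i}{2i}\Big\rceil. \]
   Context: The affine hyperoctahedral group $\widetilde{C}_n$ is the group (under composition) of bijections $w:\mathbb{Z}\to\mathbb{Z}$ with $w(i+N)=w(i)+N$ and $w(-i)=-w(i)$; it is a Coxeter group with generators $s_0,\dots,s_n$, where $s_i$ ($1\le i\le n-1$) exchanges $i$ and $i+1$, $s_0$ exchanges $-1$ and $1$, and $s_n$ exchanges $n$ and $n+2$ (each extended by the two symmetry conditions). Write $w_i=w(i)$. $C_n$ is the parabolic subgroup generated by $s_0,\dots,s_{n-1}$ (identified with signed permutations of $\{1,\dots,n\}$), and $\widetilde{C}_n/C_n$ is the set of minimal length coset representatives, exactly the $w$ with $0<w_1<\cdots<w_n$; each has a unique representation $w_i=c_iN+\sigma_i$ with $\sigma$ a signed permutation. $\alpha(w)$ is the number of occurrences of $s_0$ in any reduced word for $w$. $\mathsf{neg}(w)=\#\{i:\sigma_i<0\}$. $\Psi(\sigma)=(e_1,\dots,e_n)$ where, with $e^*_i=\#\{j<i:|\sigma_j|>|\sigma_i|\}$,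 $e_i=e^*_i$ if $\sigma_i>0$ and $e_i=2i-1-e^*_i$ if $\sigma_i<0$. $L_n$ is the set of integer tuples with $0\le\lambda_1/1\le\cdots\le\lambda_n/n$. -}

module Defs where

open import Data.Nat as ℕ using (ℕ; zero; suc)
open import Data.Integer as ℤ using (ℤ; +_; _-_; -_; _<_; _/ℕ_; _%ℕ_)
open import Data.Fin using (Fin; toℕ)
open import Data.List using (List; []; _∷_; length)
open import Data.Bool using (Bool; true; false; if_then_else_)
open import Relation.Nullary.Decidable using (⌊_⌋)
open import Function using (id; _∘_)
open import Data.Product using (_×_)
open import Relation.Nullary using (yes; no)
open import Relation.Binary.PropositionalEquality using (_≡_)

N : ℕ → ℕ
N n = 2 ℕ.+ 2 ℕ.* n

resN : ℕ → ℤ → ℕ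
resN n j = j %ℕ N n

congN : ℕ → ℤ → ℤ → Bool
congN n j a = ⌊ resN n j ℕ.≟ resN n a ⌋

-- the periodic transposition exchanging a and b (and all their translates by N):
-- j ≡ a ↦ j + (b - a),  j ≡ b ↦ j - (b - a), otherwise fixed.
-- (assumes a ≢ b mod N)
swapP : ℕ → ℤ → ℤ → ℤ → ℤ
swapP n a b j =
  if congN n j a then j ℤ.+ (b - a)
  else if congN n j b then j - (b - a)
  else j

-- the Coxeter generators s_0, …, s_n of the affine hyperoctahedral group,
-- as bijections ℤ → ℤ
gen : (n : ℕ) → Fin (suc n) → ℤ → ℤ
gen n i with toℕ i
... | zero = swapP n (ℤ.-[1+ 0 ]) (+ 1)
... | suc k with suc k ℕ.≟ n
...   | yes _ = swapP n (+ n) (+ (n ℕ.+ 2))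
...   | no _ =
        swapP n (+ suc k) (+ suc (suc k)) ∘ swapP n (- (+ suc k)) (- (+ suc (suc k)))

eval : (n : ℕ) → List (Fin (suc n)) → ℤ → ℤ
eval n [] = id
eval n (i ∷ u) = gen n i ∘ eval n u

SameElt : (n : ℕ) → List (Fin (suc n)) → List (Fin (suc n)) → Set
SameElt n u v = ∀ (z : ℤ) → eval n u z ≡ eval n v z

Reduced : (n : ℕ) → List (Fin (suc n)) → Set
Reduced n u = ∀ (v : List (Fin (suc n))) → SameElt n v u → length u ℕ.≤ length v

count0 : {n : ℕ} → List (Fin (suc n)) → ℕ
count0 [] = 0
count0 (i ∷ u) with toℕ i
... | zero = suc (count0 u)
... | suc _ = count0 u

-- w is a minimal length coset representative of C̃_n / C_n : 0 < w_1 < ⋯ < w_n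
-- (indices i are 1-based)
IsMinCosetRep : ℕ → (ℤ → ℤ) → Set
IsMinCosetRep n w = (+ 0 < w (+ 1)) × (∀ (i : ℕ) → 1 ℕ.≤ i → i ℕ.< n → w (+ i) < w (+ suc i))

-- decomposition w_i = c_i N + σ_i with σ_i ∈ {±1, …, ±n}:
-- if r = w_i mod N ≤ n then σ_i = r, c_i = ⌊w_i / N⌋; else σ_i = r - N, c_i = ⌊w_i / N⌋ + 1.
cW : ℕ → (ℤ → ℤ) → ℕ → ℤ
cW n w i = if ⌊ resN n (w (+ i)) ℕ.≤? n ⌋ then (w (+ i) /ℕ N n) else (w (+ i) /ℕ N n) ℤ.+ + 1

σW : ℕ → (ℤ → ℤ) → ℕ → ℤ
σW n w i = w (+ i) - cW n w i ℤ.* + N n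

sumTo : ℕ → (ℕ → ℤ) → ℤ
sumTo zero f = + 0
sumTo (suc m) f = sumTo m f ℤ.+ f (suc m)

countTo : ℕ → (ℕ → Bool) → ℕ
countTo zero p = 0
countTo (suc m) p = (if p (suc m) then 1 else 0) ℕ.+ countTo m p

negW : ℕ → (ℤ → ℤ) → ℕ
negW n w = countTo n (λ i → ⌊ σW n w i ℤ.<? + 0 ⌋)

eStar : (ℕ → ℤ) → ℕ → ℕ
eStar σ i = countTo (i ℕ.∸ 1) (λ j → ⌊ ℤ.∣ σ i ∣ ℕ.<? ℤ.∣ σ j ∣ ⌋)

Ψ : (ℕ → ℤ) → ℕ → ℤ
Ψ σ i = if ⌊ + 0 ℤ.<? σ i ⌋ then + eStar σ i else + (2 ℕ.* i ℕ.∸ 1) - + eStar σ i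

lamW : ℕ → (ℤ → ℤ) → ℕ → ℤ
lamW n w i = + (2 ℕ.* i) ℤ.* cW n w i - Ψ (σW n w) i

-- ⌈ a / d ⌉ for d > 0 (the value at d = 0 is an irrelevant dummy; only d ≥ 1 is used)
ceilDiv : ℤ → ℕ → ℤ
ceilDiv a zero = + 0
ceilDiv a (suc d) = - ((- a) /ℕ suc d)

-- The generators other than s₀ preserve every quotient ⌊x/N⌋ (they exchange values inside one
-- period), while s₀ raises it by one only for x ≡ −1 (mod N); as the window entries of w lie in
-- distinct residue classes, F(w) = Σᵢ ⌊wᵢ/N⌋ grows by at most one per letter s₀, so every word for
-- w has at least F(w) letters s₀.  Moreover ⌊wᵢ/N⌋ = cᵢ − [σᵢ < 0].
-- Conversely, let B(w) count the inversions of the inverse window P = (w⁻¹(1), …, w⁻¹(n)):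
-- pairs t < t' contribute |⌊(P t' − P t)/N⌋| + |⌊(P t + P t')/N⌋| and each t contributes
-- |⌊(P t + n + 1)/N⌋|.  The letter s₀ leaves B fixed and the others change it by at most one.
-- If all quotients of w are nonnegative (as for a minimal coset representative) and w ≠ 1, then P
-- has a descent, and the corresponding generator lowers B + F by exactly one while keeping the
-- quotients nonnegative.  Hence w has a word of length at most B + F, and a reduced word u satisfies
-- #s₀(u) + #others(u) = |u| ≤ B + F ≤ #others(u) + F, i.e. #s₀(u) ≤ F.
-- The second equality holds termwise: λᵢ = 2icᵢ − eᵢ with 0 ≤ e*ᵢ < i gives
-- ⌈λᵢ/i⌉ − ⌈λᵢ/2i⌉ = cᵢ − [σᵢ < 0].

module Submission where

module AffineC where
  open import Defs
  open import Data.Nat as ℕ using (ℕ; zero; suc; z≤n; s≤s)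
  import Data.Nat.Properties as NP
  open import Data.Integer as ℤ using (ℤ; +_; -[1+_]; _+_; _-_; -_; _*_; _/ℕ_; _%ℕ_; _≤_; _<_; +≤+; +<+; -≤+)
  import Data.Integer.Properties as ZP
  open import Data.Integer.DivMod using (a≡a%ℕn+[a/ℕn]*n; n%ℕd<d)
  open import Data.Integer.Tactic.RingSolver using (solve-∀)
  open import Data.Fin using (Fin; toℕ)
  import Data.Fin
  import Data.Fin.Properties
  open import Data.List using (List; []; _∷_; _++_; reverse; [_]; length)
  import Data.List.Properties as LP
  open import Data.Bool using (Bool; true; false; if_then_else_)
  open import Relation.Nullary.Decidable using (⌊_⌋)
  open import Relation.Binary.PropositionalEquality hiding ([_])
  open import Data.Product
  open import Data.Sum using (_⊎_; inj₁; inj₂)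
  open import Data.Empty
  open import Relation.Nullary
  open import Function using (case_of_; _∘_)
  import Data.Nat.Tactic.RingSolver as ℕ-Ring

  +-≡-cancel-≤ : ∀ x y a b → x ℕ.+ a ≡ y ℕ.+ b → b ℕ.≤ suc a → x ℕ.≤ suc y
  +-≡-cancel-≤ x y a b eq b≤1+a = NP.+-cancelʳ-≤ a x (suc y) (begin
    x ℕ.+ a        ≡⟨ eq ⟩
    y ℕ.+ b        ≤⟨ NP.+-monoʳ-≤ y b≤1+a ⟩
    y ℕ.+ suc a    ≡⟨ NP.+-suc y a ⟩
    suc y ℕ.+ a    ∎)
    where open NP.≤-Reasoning

  +-≡-cancel-suc : ∀ x y b → x ℕ.+ suc b ≡ y ℕ.+ b → suc x ≡ y
  +-≡-cancel-suc x y b eq = NP.+-cancelʳ-≡ b (suc x) y (trans (sym (NP.+-suc x b)) eq)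

  bounded-multiple≡0 : ∀ {M a b : ℕ} (k : ℤ) → a ℕ.< M → b ℕ.< M → + a + k * + M ≡ + b → k ≡ + 0
  bounded-multiple≡0 (+ zero) a<M b<M eq = refl
  bounded-multiple≡0 {M} {a} {b} (+ suc j) a<M b<M eq = ⊥-elim (NP.<⇒≱ b<M M≤b)
    where
    M≤b : M ℕ.≤ b
    M≤b = begin
      M                       ≤⟨ NP.m≤m+n M (j ℕ.* M) ⟩
      suc j ℕ.* M             ≤⟨ NP.m≤n+m _ a ⟩
      a ℕ.+ suc j ℕ.* M       ≡⟨ ZP.+-injective (trans (ZP.pos-+ a _) (trans (cong (_+_ (+ a)) (ZP.pos-* (suc j) M)) eq)) ⟩
      b                       ∎
      where open NP.≤-Reasoning
  bounded-multiple≡0 {M} {a} {b} -[1+ j ] a<M b<M eq = ⊥-elim (NP.<⇒≱ a<M M≤a)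
    where
    move : ∀ (a b k m : ℤ) → a + (- k) * m ≡ b → a ≡ b + k * m
    move a b k m e = trans (l a k m) (cong (_+ k * m) e)
      where
      l : ∀ (a k m : ℤ) → a ≡ a + (- k) * m + k * m
      l = solve-∀
    M≤a : M ℕ.≤ a
    M≤a = begin
      M                       ≤⟨ NP.m≤m+n M (j ℕ.* M) ⟩
      suc j ℕ.* M             ≤⟨ NP.m≤n+m _ b ⟩
      b ℕ.+ suc j ℕ.* M       ≡⟨ ZP.+-injective (sym (trans (move (+ a) (+ b) (+ suc j) (+ M) eq)
                                   (trans (cong (_+_ (+ b)) (sym (ZP.pos-* (suc j) M))) (sym (ZP.pos-+ b _))))) ⟩
      a                       ∎
      where open NP.≤-Reasoning

  divMod-unique : ∀ d .{{_ : ℕ.NonZero d}} x (a : ℕ) (k : ℤ) → a ℕ.< d → x ≡ + a + k * + d →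
                  (x %ℕ d ≡ a) × (x /ℕ d ≡ k)
  divMod-unique d x a k a<d eq = ZP.+-injective (trans (sym diff) (trans (cong (λ z → + a + z * + d) k-q≡0) (ZP.+-identityʳ (+ a)))) ,
                                 sym (ZP.i-j≡0⇒i≡j k (x /ℕ d) k-q≡0)
    where
    move : ∀ (a k r q m : ℤ) → a + k * m ≡ r + q * m → a + (k - q) * m ≡ r
    move a k r q m e = trans (l a k q m) (trans (cong (_- q * m) e) (l' r q m))
      where
      l : ∀ (a k q m : ℤ) → a + (k - q) * m ≡ a + k * m - q * m
      l = solve-∀
      l' : ∀ (r q m : ℤ) → r + q * m - q * m ≡ r
      l' = solve-∀
    diff : + a + (k - x /ℕ d) * + d ≡ + (x %ℕ d)
    diff = move (+ a) k (+ (x %ℕ d)) (x /ℕ d) (+ d) (trans (sym eq) (a≡a%ℕn+[a/ℕn]*n x d))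
    k-q≡0 : k - x /ℕ d ≡ + 0
    k-q≡0 = bounded-multiple≡0 (k - x /ℕ d) a<d (n%ℕd<d x d) diff

  +-suc-ℤ : ∀ c → + c + + 1 ≡ + suc c
  +-suc-ℤ c = trans (sym (ZP.pos-+ c 1)) (cong +_ (NP.+-comm c 1))

  +-cancelʳ-≤ : ∀ a b c → a + c ≤ b + c → a ≤ b
  +-cancelʳ-≤ a b c a+c≤b+c = subst₂ _≤_ (cancel a c) (cancel b c) (ZP.+-monoˡ-≤ (- c) a+c≤b+c)
    where
    cancel : ∀ (x c : ℤ) → x + c + - c ≡ x
    cancel = solve-∀

  x≡-x⇒x≡0 : ∀ x → x ≡ - x → x ≡ + 0
  x≡-x⇒x≡0 (+ zero) e = refl
  x≡-x⇒x≡0 (+ suc m) ()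
  x≡-x⇒x≡0 -[1+ m ] ()

  <-suc⇒≤ : ∀ x m → x < + suc m → x ≤ + m
  <-suc⇒≤ (+ a) m (ℤ.+<+ p) = ℤ.+≤+ (NP.≤-pred p)
  <-suc⇒≤ -[1+ a ] m p = ℤ.-≤+

  ceilDiv-unique : ∀ d (r : ℕ) (k : ℤ) → r ℕ.< suc d → ceilDiv (k * + suc d - + r) (suc d) ≡ k
  ceilDiv-unique d r k r<d =
    trans (cong -_ (proj₂ (divMod-unique (suc d) _ r (- k) r<d (l k (+ r) (+ suc d))))) (ZP.neg-involutive k)
    where
    l : ∀ (k r m : ℤ) → - (k * m - r) ≡ r + (- k) * m
    l = solve-∀

  -- Inversion sums of finite sequences

  transposeAt : ℕ → ℕ → ℕ
  transposeAt zero zero = suc zero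
  transposeAt zero (suc zero) = zero
  transposeAt zero (suc (suc t)) = suc (suc t)
  transposeAt (suc k) zero = zero
  transposeAt (suc k) (suc t) = suc (transposeAt k t)

  transposeAt-k : ∀ k → transposeAt k k ≡ suc k
  transposeAt-k zero = refl
  transposeAt-k (suc k) = cong suc (transposeAt-k k)

  transposeAt-suc : ∀ k → transposeAt k (suc k) ≡ k
  transposeAt-suc zero = refl
  transposeAt-suc (suc k) = cong suc (transposeAt-suc k)

  transposeAt-other : ∀ k t → t ≢ k → t ≢ suc k → transposeAt k t ≡ t
  transposeAt-other zero zero t≢k t≢1+k = ⊥-elim (t≢k refl)
  transposeAt-other zero (suc zero) t≢k t≢1+k = ⊥-elim (t≢1+k refl)
  transposeAt-other zero (suc (suc t)) t≢k t≢1+k = refl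
  transposeAt-other (suc k) zero t≢k t≢1+k = refl
  transposeAt-other (suc k) (suc t) t≢k t≢1+k =
    cong suc (transposeAt-other k t (t≢k ∘ cong suc) (t≢1+k ∘ cong suc))

  module _ {A : Set} where
    swapAt : ℕ → (ℕ → A) → ℕ → A
    swapAt k f t = f (transposeAt k t)

    update : ℕ → A → (ℕ → A) → ℕ → A
    update zero a f zero = a
    update zero a f (suc t) = f (suc t)
    update (suc j) a f zero = f zero
    update (suc j) a f (suc t) = update j a (f ∘ suc) t

    update-here : ∀ j a f → update j a f j ≡ a
    update-here zero a f = refl
    update-here (suc j) a f = update-here j a (f ∘ suc)

    update-other : ∀ j a f t → t ≢ j → update j a f t ≡ f t
    update-other zero a f zero t≢j = ⊥-elim (t≢j refl)
    update-other zero a f (suc t) t≢j = refl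
    update-other (suc j) a f zero t≢j = refl
    update-other (suc j) a f (suc t) t≢j = update-other j a (f ∘ suc) t (t≢j ∘ cong suc)

  module InversionSums {A : Set} (pair : A → A → ℕ) (point : A → ℕ) where
    rowSum : A → (ℕ → A) → ℕ → ℕ
    rowSum a f zero = 0
    rowSum a f (suc L) = pair a (f 0) ℕ.+ rowSum a (f ∘ suc) L

    pairSum : (ℕ → A) → ℕ → ℕ
    pairSum f zero = 0
    pairSum f (suc L) = rowSum (f 0) (f ∘ suc) L ℕ.+ pairSum (f ∘ suc) L

    pointSum : (ℕ → A) → ℕ → ℕ
    pointSum f zero = 0
    pointSum f (suc L) = point (f 0) ℕ.+ pointSum (f ∘ suc) L

    AgreeBelow : ℕ → (ℕ → A) → (ℕ → A) → Set
    AgreeBelow L f g = ∀ t → t ℕ.< L → f t ≡ g t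

    private
      AgreeBelow-suc : ∀ {L f g} → AgreeBelow (suc L) f g → AgreeBelow L (f ∘ suc) (g ∘ suc)
      AgreeBelow-suc f≗g t t<L = f≗g (suc t) (s≤s t<L)

      exchange : ∀ x y r → x ℕ.+ (y ℕ.+ r) ≡ y ℕ.+ (x ℕ.+ r)
      exchange = ℕ-Ring.solve-∀

    rowSum-cong : ∀ a f g L → AgreeBelow L f g → rowSum a f L ≡ rowSum a g L
    rowSum-cong a f g zero f≗g = refl
    rowSum-cong a f g (suc L) f≗g =
      cong₂ ℕ._+_ (cong (pair a) (f≗g 0 (s≤s z≤n))) (rowSum-cong a _ _ L (AgreeBelow-suc f≗g))

    pairSum-cong : ∀ f g L → AgreeBelow L f g → pairSum f L ≡ pairSum g L
    pairSum-cong f g zero f≗g = refl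
    pairSum-cong f g (suc L) f≗g =
      cong₂ ℕ._+_ (trans (cong (λ a → rowSum a (f ∘ suc) L) (f≗g 0 (s≤s z≤n))) (rowSum-cong _ _ _ L (AgreeBelow-suc f≗g)))
                  (pairSum-cong _ _ L (AgreeBelow-suc f≗g))

    pointSum-cong : ∀ f g L → AgreeBelow L f g → pointSum f L ≡ pointSum g L
    pointSum-cong f g zero f≗g = refl
    pointSum-cong f g (suc L) f≗g =
      cong₂ ℕ._+_ (cong point (f≗g 0 (s≤s z≤n))) (pointSum-cong _ _ L (AgreeBelow-suc f≗g))

    rowSum-swap : ∀ a k f L → suc k ℕ.< L → rowSum a (swapAt k f) L ≡ rowSum a f L
    rowSum-swap a zero f (suc (suc L)) _ = exchange (pair a (f 1)) (pair a (f 0)) (rowSum a (f ∘ suc ∘ suc) L)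
    rowSum-swap a zero f (suc zero) (s≤s ())
    rowSum-swap a (suc k) f (suc L) (s≤s k<L) = cong (pair a (f 0) ℕ.+_) (rowSum-swap a k (f ∘ suc) L k<L)

    pointSum-swap : ∀ k f L → suc k ℕ.< L → pointSum (swapAt k f) L ≡ pointSum f L
    pointSum-swap zero f (suc (suc L)) _ = exchange (point (f 1)) (point (f 0)) (pointSum (f ∘ suc ∘ suc) L)
    pointSum-swap zero f (suc zero) (s≤s ())
    pointSum-swap (suc k) f (suc L) (s≤s k<L) = cong (point (f 0) ℕ.+_) (pointSum-swap k (f ∘ suc) L k<L)

    pairSum-swap : ∀ k f L → suc k ℕ.< L →
                   pairSum (swapAt k f) L ℕ.+ pair (f k) (f (suc k)) ≡ pairSum f L ℕ.+ pair (f (suc k)) (f k)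
    pairSum-swap zero f (suc (suc L)) _ =
      rearrange (pair (f 0) (f 1)) (pair (f 1) (f 0)) (rowSum (f 0) (f ∘ suc ∘ suc) L) (rowSum (f 1) (f ∘ suc ∘ suc) L) (pairSum (f ∘ suc ∘ suc) L)
      where
      rearrange : ∀ a a' r₀ r₁ p → (a' ℕ.+ r₁) ℕ.+ (r₀ ℕ.+ p) ℕ.+ a ≡ (a ℕ.+ r₀) ℕ.+ (r₁ ℕ.+ p) ℕ.+ a'
      rearrange = ℕ-Ring.solve-∀
    pairSum-swap zero f (suc zero) (s≤s ())
    pairSum-swap (suc k) f (suc L) (s≤s k<L) = begin
      rowSum (f 0) (swapAt k (f ∘ suc)) L ℕ.+ pairSum (swapAt k (f ∘ suc)) L ℕ.+ pair (f (suc k)) (f (suc (suc k)))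
        ≡⟨ NP.+-assoc (rowSum (f 0) (swapAt k (f ∘ suc)) L) _ _ ⟩
      rowSum (f 0) (swapAt k (f ∘ suc)) L ℕ.+ (pairSum (swapAt k (f ∘ suc)) L ℕ.+ pair (f (suc k)) (f (suc (suc k))))
        ≡⟨ cong₂ ℕ._+_ (rowSum-swap (f 0) k (f ∘ suc) L k<L) (pairSum-swap k (f ∘ suc) L k<L) ⟩
      rowSum (f 0) (f ∘ suc) L ℕ.+ (pairSum (f ∘ suc) L ℕ.+ pair (f (suc (suc k))) (f (suc k)))
        ≡⟨ NP.+-assoc (rowSum (f 0) (f ∘ suc) L) _ _ ⟨
      rowSum (f 0) (f ∘ suc) L ℕ.+ pairSum (f ∘ suc) L ℕ.+ pair (f (suc (suc k))) (f (suc k)) ∎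
      where open ≡-Reasoning

    pairSum-update-head : ∀ a' f L → (∀ b → pair a' b ≡ pair (f 0) b) → pairSum (update 0 a' f) (suc L) ≡ pairSum f (suc L)
    pairSum-update-head a' f L same = cong (ℕ._+ pairSum (f ∘ suc) L) (rowSum-head L)
      where
      rowSum-head : ∀ {g} L → rowSum a' g L ≡ rowSum (f 0) g L
      rowSum-head zero = refl
      rowSum-head {g} (suc L) = cong₂ ℕ._+_ (same (g 0)) (rowSum-head L)

    pointSum-update-head : ∀ a' f L → pointSum (update 0 a' f) (suc L) ℕ.+ point (f 0) ≡ pointSum f (suc L) ℕ.+ point a'
    pointSum-update-head a' f L = rearrange (point a') (pointSum (f ∘ suc) L) (point (f 0))
      where
      rearrange : ∀ a b c → (a ℕ.+ b) ℕ.+ c ≡ (c ℕ.+ b) ℕ.+ a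
      rearrange = ℕ-Ring.solve-∀

    pairSum-update-last : ∀ j a' f → (∀ t → t ℕ.< j → pair (f t) a' ≡ pair (f t) (f j)) →
                          pairSum (update j a' f) (suc j) ≡ pairSum f (suc j)
    pairSum-update-last zero a' f same = refl
    pairSum-update-last (suc j) a' f same =
      cong₂ ℕ._+_ (rowSum-last j (f ∘ suc) (same 0 (s≤s z≤n))) (pairSum-update-last j a' (f ∘ suc) (λ t t<j → same (suc t) (s≤s t<j)))
      where
      rowSum-last : ∀ j g → pair (f 0) a' ≡ pair (f 0) (g j) → rowSum (f 0) (update j a' g) (suc j) ≡ rowSum (f 0) g (suc j)
      rowSum-last zero g eq = cong (ℕ._+ 0) eq
      rowSum-last (suc j) g eq = cong (pair (f 0) (g 0) ℕ.+_) (rowSum-last j (g ∘ suc) eq)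

    pointSum-update-last : ∀ j a' f → pointSum (update j a' f) (suc j) ℕ.+ point (f j) ≡ pointSum f (suc j) ℕ.+ point a'
    pointSum-update-last zero a' f = pointSum-update-head a' f 0
    pointSum-update-last (suc j) a' f = begin
      point (f 0) ℕ.+ pointSum (update j a' (f ∘ suc)) (suc j) ℕ.+ point (f (suc j))
        ≡⟨ NP.+-assoc (point (f 0)) _ _ ⟩
      point (f 0) ℕ.+ (pointSum (update j a' (f ∘ suc)) (suc j) ℕ.+ point (f (suc j)))
        ≡⟨ cong (point (f 0) ℕ.+_) (pointSum-update-last j a' (f ∘ suc)) ⟩
      point (f 0) ℕ.+ (pointSum (f ∘ suc) (suc j) ℕ.+ point a')
        ≡⟨ NP.+-assoc (point (f 0)) _ _ ⟨
      point (f 0) ℕ.+ pointSum (f ∘ suc) (suc j) ℕ.+ point a' ∎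
      where open ≡-Reasoning

    pairSum-zero : ∀ f L → (∀ t t' → t ℕ.< t' → t' ℕ.< L → pair (f t) (f t') ≡ 0) → pairSum f L ≡ 0
    pairSum-zero f zero _ = refl
    pairSum-zero f (suc L) vanish =
      cong₂ ℕ._+_ (rowSum-zero L (f ∘ suc) (λ t t<L → vanish 0 (suc t) (s≤s z≤n) (s≤s t<L)))
                  (pairSum-zero (f ∘ suc) L (λ t t' t<t' t'<L → vanish (suc t) (suc t') (s≤s t<t') (s≤s t'<L)))
      where
      rowSum-zero : ∀ L g → (∀ t → t ℕ.< L → pair (f 0) (g t) ≡ 0) → rowSum (f 0) g L ≡ 0
      rowSum-zero zero g _ = refl
      rowSum-zero (suc L) g vanish′ = cong₂ ℕ._+_ (vanish′ 0 (s≤s z≤n)) (rowSum-zero L (g ∘ suc) (λ t t<L → vanish′ (suc t) (s≤s t<L)))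

    pointSum-zero : ∀ f L → (∀ t → t ℕ.< L → point (f t) ≡ 0) → pointSum f L ≡ 0
    pointSum-zero f zero _ = refl
    pointSum-zero f (suc L) vanish = cong₂ ℕ._+_ (vanish 0 (s≤s z≤n)) (pointSum-zero (f ∘ suc) L (λ t t<L → vanish (suc t) (s≤s t<L)))

  InRange : ℕ → ℕ → Set
  InRange m i = 1 ℕ.≤ i × i ℕ.≤ m

  InRange-suc : ∀ {m i} → InRange m i → InRange (suc m) i
  InRange-suc (a , b) = a , NP.m≤n⇒m≤1+n b

  sumTo-cong : ∀ m f g → (∀ i → InRange m i → f i ≡ g i) → sumTo m f ≡ sumTo m g
  sumTo-cong zero f g e = refl
  sumTo-cong (suc m) f g e = cong₂ _+_ (sumTo-cong m f g (λ i p → e i (InRange-suc p))) (e (suc m) (s≤s z≤n , NP.≤-refl))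

  sumTo-mono-≤ : ∀ m f g → (∀ i → InRange m i → f i ≤ g i) → sumTo m f ≤ sumTo m g
  sumTo-mono-≤ zero f g e = ZP.≤-refl
  sumTo-mono-≤ (suc m) f g e = ZP.+-mono-≤ (sumTo-mono-≤ m f g (λ i p → e i (InRange-suc p))) (e (suc m) (s≤s z≤n , NP.≤-refl))

  sumTo-+ : ∀ m f g → sumTo m (λ i → f i + g i) ≡ sumTo m f + sumTo m g
  sumTo-+ zero f g = refl
  sumTo-+ (suc m) f g = trans (cong (_+ (f (suc m) + g (suc m))) (sumTo-+ m f g)) (l (sumTo m f) (sumTo m g) (f (suc m)) (g (suc m)))
    where
    l : ∀ (a b c d : ℤ) → a + b + (c + d) ≡ a + c + (b + d)
    l = solve-∀

  sumTo-zero : ∀ m d → (∀ i → InRange m i → d i ≡ + 0) → sumTo m d ≡ + 0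
  sumTo-zero zero d e = refl
  sumTo-zero (suc m) d e = cong₂ _+_ (sumTo-zero m d (λ i p → e i (InRange-suc p))) (e (suc m) (s≤s z≤n , NP.≤-refl))

  sumTo-single : ∀ m d i0 → InRange m i0 → (∀ j → InRange m j → j ≢ i0 → d j ≡ + 0) → sumTo m d ≡ d i0
  sumTo-single zero d i0 (a , b) e = ⊥-elim (NP.<-irrefl refl (NP.≤-trans a b))
  sumTo-single (suc m) d i0 p e with i0 ℕ.≟ suc m
  ... | yes refl = trans (cong (_+ d (suc m)) (sumTo-zero m d (λ j q → e j (InRange-suc q) (λ r → NP.<-irrefl refl (subst (ℕ._≤ m) r (proj₂ q)))))) (ZP.+-identityˡ _)
  ... | no ne = trans (cong₂ _+_ (sumTo-single m d i0 (proj₁ p , NP.≤-pred (NP.≤∧≢⇒< (proj₂ p) ne)) (λ j q r → e j (InRange-suc q) r)) (e (suc m) (s≤s z≤n , NP.≤-refl) (λ r → ne (sym r)))) (ZP.+-identityʳ _)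

  sumTo-≤1 : ∀ m d (Q : ℕ → Set) → (∀ i → InRange m i → d i ≤ + 1) → (∀ i → InRange m i → ¬ Q i → d i ≤ + 0)
            → (∀ i j → InRange m i → InRange m j → Q i → Q j → i ≡ j) → (∀ i → Dec (Q i)) → sumTo m d ≤ + 1
  sumTo-≤1 zero d Q a b c dq = ℤ.+≤+ z≤n
  sumTo-≤1 (suc m) d Q a b c dq with dq (suc m)
  ... | yes q = subst (_≤ + 1) (ZP.+-comm (d (suc m)) (sumTo m d)) (subst (d (suc m) + sumTo m d ≤_) (ZP.+-identityʳ (+ 1))
         (ZP.+-mono-≤ (a (suc m) top) (sub0 m (λ i p → b i (InRange-suc p) (λ qi → NP.<-irrefl (c i (suc m) (InRange-suc p) top qi q) (s≤s (proj₂ p)))))))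
    where
    top = s≤s z≤n , NP.≤-refl
    sub0 : ∀ k → (∀ i → InRange k i → d i ≤ + 0) → sumTo k d ≤ + 0
    sub0 zero e = ZP.≤-refl
    sub0 (suc k) e = ZP.+-mono-≤ (sub0 k (λ i p → e i (InRange-suc p))) (e (suc k) (s≤s z≤n , NP.≤-refl))
  ... | no nq = subst (sumTo m d + d (suc m) ≤_) (ZP.+-identityʳ (+ 1)) (ZP.+-mono-≤ (sumTo-≤1 m d Q (λ i p → a i (InRange-suc p)) (λ i p → b i (InRange-suc p)) (λ i j p p' → c i j (InRange-suc p) (InRange-suc p')) dq) (b (suc m) (s≤s z≤n , NP.≤-refl) nq))

  sumTo-−countTo : ∀ m f (p : ℕ → Bool) → sumTo m f - + countTo m p ≡ sumTo m (λ i → f i - + (if p i then 1 else 0))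
  sumTo-−countTo zero f p = refl
  sumTo-−countTo (suc m) f p = trans (cong (λ z → sumTo m f + f (suc m) - z) (ZP.pos-+ (if p (suc m) then 1 else 0) (countTo m p)))
     (trans (l (sumTo m f) (f (suc m)) (+ (if p (suc m) then 1 else 0)) (+ countTo m p)) (cong (_+ (f (suc m) - + (if p (suc m) then 1 else 0))) (sumTo-−countTo m f p)))
    where
    l : ∀ (a b c d : ℤ) → a + b - (c + d) ≡ a - d + (b - c)
    l = solve-∀

  sumTo-− : ∀ m f g → sumTo m f - sumTo m g ≡ sumTo m (λ i → f i - g i)
  sumTo-− zero f g = refl
  sumTo-− (suc m) f g = trans (l (sumTo m f) (sumTo m g) (f (suc m)) (g (suc m))) (cong (_+ (f (suc m) - g (suc m))) (sumTo-− m f g))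
    where
    l : ∀ (a b c d : ℤ) → a + c - (b + d) ≡ a - b + (c - d)
    l = solve-∀

  countTo≤ : ∀ m p → countTo m p ℕ.≤ m
  countTo≤ zero p = z≤n
  countTo≤ (suc m) p with p (suc m)
  ... | true = s≤s (countTo≤ m p)
  ... | false = NP.m≤n⇒m≤1+n (countTo≤ m p)

  eStar≤ : ∀ σ i → eStar σ (suc i) ℕ.≤ i
  eStar≤ σ i = countTo≤ i _

  -- Ceilings and the map Ψ

  negIndicator-0 : ∀ y → ¬ (y < + 0) → (if ⌊ y ℤ.<? + 0 ⌋ then 1 else 0) ≡ 0
  negIndicator-0 y ne with y ℤ.<? + 0
  ... | yes p = ⊥-elim (ne p)
  ... | no _ = refl

  negIndicator-1 : ∀ y → y < + 0 → (if ⌊ y ℤ.<? + 0 ⌋ then 1 else 0) ≡ 1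
  negIndicator-1 y p with y ℤ.<? + 0
  ... | yes _ = refl
  ... | no ne = ⊥-elim (ne p)

  Ψ-pos : ∀ σ i → + 0 < σ i → Ψ σ i ≡ + eStar σ i
  Ψ-pos σ i p with + 0 ℤ.<? σ i
  ... | yes _ = refl
  ... | no np = ⊥-elim (np p)

  Ψ-neg : ∀ σ i → ¬ (+ 0 < σ i) → Ψ σ i ≡ + (2 ℕ.* i ℕ.∸ 1) - + eStar σ i
  Ψ-neg σ i np with + 0 ℤ.<? σ i
  ... | yes p = ⊥-elim (np p)
  ... | no _ = refl

  ceil-difference : ∀ (σ : ℕ → ℤ) (i : ℕ) (c : ℤ) → (+ 0 < σ (suc i)) ⊎ (σ (suc i) < + 0) →
    ceilDiv (+ (2 ℕ.* suc i) * c - Ψ σ (suc i)) (suc i) - ceilDiv (+ (2 ℕ.* suc i) * c - Ψ σ (suc i)) (2 ℕ.* suc i)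
      ≡ c - + (if ⌊ σ (suc i) ℤ.<? + 0 ⌋ then 1 else 0)
  ceil-difference σ i c (inj₁ pos) = begin
      ceilDiv λ′ (suc i) - ceilDiv λ′ (2 ℕ.* suc i)
        ≡⟨ cong₂ (λ a b → ceilDiv a (suc i) - ceilDiv b (2 ℕ.* suc i)) (byI (Ψ-pos σ (suc i) pos)) (by2I (Ψ-pos σ (suc i) pos)) ⟩
      ceilDiv (+ 2 * c * + suc i - + e) (suc i) - ceilDiv (c * + (2 ℕ.* suc i) - + e) (2 ℕ.* suc i)
        ≡⟨ cong₂ _-_ (ceilDiv-unique i e (+ 2 * c) (s≤s e≤i)) (ceilDiv-unique _ e c (s≤s (NP.m≤n⇒m≤n+o _ e≤i))) ⟩
      + 2 * c - c
        ≡⟨ l c ⟩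
      c - + 0
        ≡⟨ cong (λ z → c - + z) (sym (negIndicator-0 (σ (suc i)) (ZP.<-asym pos))) ⟩
      c - + (if ⌊ σ (suc i) ℤ.<? + 0 ⌋ then 1 else 0) ∎
    where
    open ≡-Reasoning
    λ′ = + (2 ℕ.* suc i) * c - Ψ σ (suc i)
    e = eStar σ (suc i)
    e≤i = eStar≤ σ i
    byI : Ψ σ (suc i) ≡ + e → λ′ ≡ + 2 * c * + suc i - + e
    byI p = trans (cong₂ (λ a b → a * c - b) (ZP.pos-* 2 (suc i)) p) (l′ c (+ e) (+ suc i))
      where
      l′ : ∀ (c e i : ℤ) → + 2 * i * c - e ≡ + 2 * c * i - e
      l′ = solve-∀
    by2I : Ψ σ (suc i) ≡ + e → λ′ ≡ c * + (2 ℕ.* suc i) - + e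
    by2I p = cong₂ (λ a b → a - b) (ZP.*-comm (+ (2 ℕ.* suc i)) c) p
    l : ∀ (c : ℤ) → + 2 * c - c ≡ c - + 0
    l = solve-∀
  ceil-difference σ i c (inj₂ neg) = begin
      ceilDiv λ′ (suc i) - ceilDiv λ′ (2 ℕ.* suc i)
        ≡⟨ cong₂ (λ a b → ceilDiv a (suc i) - ceilDiv b (2 ℕ.* suc i)) byI by2I ⟩
      ceilDiv ((+ 2 * c - + 1) * + suc i - + (i ℕ.∸ e)) (suc i) - ceilDiv (c * + (2 ℕ.* suc i) - + (M ℕ.∸ e)) (2 ℕ.* suc i)
        ≡⟨ cong₂ _-_ (ceilDiv-unique i (i ℕ.∸ e) (+ 2 * c - + 1) (s≤s (NP.m∸n≤m i e)))
                     (ceilDiv-unique _ (M ℕ.∸ e) c (s≤s (NP.m∸n≤m M e))) ⟩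
      + 2 * c - + 1 - c
        ≡⟨ l c ⟩
      c - + 1
        ≡⟨ cong (λ z → c - + z) (sym (negIndicator-1 (σ (suc i)) neg)) ⟩
      c - + (if ⌊ σ (suc i) ℤ.<? + 0 ⌋ then 1 else 0) ∎
    where
    open ≡-Reasoning
    λ′ = + (2 ℕ.* suc i) * c - Ψ σ (suc i)
    e = eStar σ (suc i)
    M = 2 ℕ.* suc i ℕ.∸ 1
    e≤i = eStar≤ σ i
    M≡1+2i : M ≡ 1 ℕ.+ 2 ℕ.* i
    M≡1+2i = trans (cong (i ℕ.+_) (NP.*-identityˡ (suc i))) (trans (NP.+-suc i i) (cong (λ z → suc (i ℕ.+ z)) (sym (NP.+-identityʳ i))))
    ∸-pos : ∀ {a b} → b ℕ.≤ a → + (a ℕ.∸ b) ≡ + a - + b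
    ∸-pos {a} {b} b≤a = trans (sym (ZP.⊖-≥ b≤a)) (sym (ZP.m-n≡m⊖n a b))
    byI : λ′ ≡ (+ 2 * c - + 1) * + suc i - + (i ℕ.∸ e)
    byI = begin
      + (2 ℕ.* suc i) * c - Ψ σ (suc i)
        ≡⟨ cong₂ (λ a b → a * c - b) (trans (ZP.pos-* 2 (suc i)) (cong (_*_ (+ 2)) (ZP.pos-+ 1 i))) (Ψ-neg σ (suc i) (ZP.<-asym neg)) ⟩
      + 2 * (+ 1 + + i) * c - (+ M - + e)
        ≡⟨ cong (λ m → + 2 * (+ 1 + + i) * c - (m - + e)) (trans (cong +_ M≡1+2i) (trans (ZP.pos-+ 1 (2 ℕ.* i)) (cong (_+_ (+ 1)) (ZP.pos-* 2 i)))) ⟩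
      + 2 * (+ 1 + + i) * c - (+ 1 + + 2 * + i - + e)
        ≡⟨ l′ c (+ i) (+ e) ⟩
      (+ 2 * c - + 1) * (+ 1 + + i) - (+ i - + e)
        ≡⟨ cong₂ (λ a b → (+ 2 * c - + 1) * a - b) (sym (ZP.pos-+ 1 i)) (sym (∸-pos e≤i)) ⟩
      (+ 2 * c - + 1) * + suc i - + (i ℕ.∸ e) ∎
      where
      l′ : ∀ (c i e : ℤ) → + 2 * (+ 1 + i) * c - (+ 1 + + 2 * i - e) ≡ (+ 2 * c - + 1) * (+ 1 + i) - (i - e)
      l′ = solve-∀
    by2I : λ′ ≡ c * + (2 ℕ.* suc i) - + (M ℕ.∸ e)
    by2I = cong₂ _-_ (ZP.*-comm (+ (2 ℕ.* suc i)) c)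
             (trans (Ψ-neg σ (suc i) (ZP.<-asym neg)) (sym (∸-pos (NP.≤-trans e≤i (NP.m≤m+n i _)))))
    l : ∀ (c : ℤ) → + 2 * c - + 1 - c ≡ c - + 1
    l = solve-∀

  N≡2+[n+n] : ∀ n → N n ≡ suc (suc (n ℕ.+ n))
  N≡2+[n+n] n = cong (λ z → suc (suc z)) (cong (n ℕ.+_) (NP.+-identityʳ n))

  N≡n+2+n : ∀ n → N n ≡ n ℕ.+ 2 ℕ.+ n
  N≡n+2+n n = expand n
    where
    expand : ∀ n → 2 ℕ.+ 2 ℕ.* n ≡ n ℕ.+ 2 ℕ.+ n
    expand = ℕ-Ring.solve-∀

  N≡n+[n+2] : ∀ n → N n ≡ n ℕ.+ (n ℕ.+ 2)
  N≡n+[n+2] n = expand n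
    where
    expand : ∀ n → 2 ℕ.+ 2 ℕ.* n ≡ n ℕ.+ (n ℕ.+ 2)
    expand = ℕ-Ring.solve-∀

  N≡n+[2+n] : ∀ n → N n ≡ n ℕ.+ suc (suc n)
  N≡n+[2+n] n = expand n
    where
    expand : ∀ n → 2 ℕ.+ 2 ℕ.* n ≡ n ℕ.+ suc (suc n)
    expand = ℕ-Ring.solve-∀

  module _ (n : ℕ) where
    quoN : ℤ → ℤ
    quoN x = x /ℕ N n
    resN+quoN*N : ∀ x → x ≡ + resN n x + quoN x * + N n
    resN+quoN*N x = a≡a%ℕn+[a/ℕn]*n x (N n)
    resN<N : ∀ x → resN n x ℕ.< N n
    resN<N x = n%ℕd<d x (N n)

  module _ (n : ℕ) where
    Nℤ : ℤ
    Nℤ = + N n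

    divModN-+multiple : ∀ x k → (resN n (x + k * Nℤ) ≡ resN n x) × (quoN n (x + k * Nℤ) ≡ quoN n x + k)
    divModN-+multiple x k = divMod-unique (N n) (x + k * Nℤ) (resN n x) (quoN n x + k) (resN<N n x)
       (trans (cong (λ z → z + k * Nℤ) (resN+quoN*N n x)) (lem (+ resN n x) (quoN n x) k Nℤ))
      where
      lem : ∀ (r q k m : ℤ) → r + q * m + k * m ≡ r + (q + k) * m
      lem = solve-∀

    resN-+multiple : ∀ x k → resN n (x + k * Nℤ) ≡ resN n x
    resN-+multiple x k = proj₁ (divModN-+multiple x k)

    resN≡⇒+multiple : ∀ x y → resN n x ≡ resN n y → y ≡ x + (quoN n y - quoN n x) * Nℤ
    resN≡⇒+multiple x y e = trans (resN+quoN*N n y) (trans (cong (λ z → + z + quoN n y * Nℤ) (sym e))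
                  (trans (lem (+ resN n x) (quoN n y) (quoN n x) Nℤ) (cong (λ z → z + (quoN n y - quoN n x) * Nℤ) (sym (resN+quoN*N n x)))))
      where
      lem : ∀ (r a b m : ℤ) → r + a * m ≡ r + b * m + (a - b) * m
      lem = solve-∀

    resN-small : ∀ m → m ℕ.< N n → resN n (+ m) ≡ m
    resN-small m p = proj₁ (divMod-unique (N n) (+ m) m (+ 0) p (sym (ZP.+-identityʳ (+ m))))

    quoN-small : ∀ m → m ℕ.< N n → quoN n (+ m) ≡ + 0
    quoN-small m m<N = proj₂ (divMod-unique (N n) (+ m) m (+ 0) m<N (sym (ZP.+-identityʳ (+ m))))

    resN-cong-neg : ∀ x y → resN n x ≡ resN n y → resN n (- x) ≡ resN n (- y)
    resN-cong-neg x y e = sym (trans (cong (resN n) (lem x y (quoN n y - quoN n x) (quoN n x - quoN n y) (resN≡⇒+multiple x y e))) (resN-+multiple (- x) (- (quoN n y - quoN n x))))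
      where
      lem : ∀ x y k j → y ≡ x + k * Nℤ → - y ≡ - x + (- k) * Nℤ
      lem x y k j e = trans (cong -_ e) (l2 x k Nℤ)
        where
        l2 : ∀ (x k m : ℤ) → - (x + k * m) ≡ - x + (- k) * m
        l2 = solve-∀

    resN-translate : ∀ x a b → resN n x ≡ resN n a → resN n (x + (b - a)) ≡ resN n b
    resN-translate x a b e = trans (cong (resN n) (lem x a b (quoN n x - quoN n a) (resN≡⇒+multiple a x (sym e)))) (resN-+multiple b (quoN n x - quoN n a))
      where
      lem : ∀ x a b k → x ≡ a + k * Nℤ → x + (b - a) ≡ b + k * Nℤ
      lem x a b k e = trans (cong (λ z → z + (b - a)) e) (l2 a b k Nℤ)
        where
        l2 : ∀ (a b k m : ℤ) → a + k * m + (b - a) ≡ b + k * m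
        l2 = solve-∀

    swapP-a : ∀ a b x → resN n x ≡ resN n a → swapP n a b x ≡ x + (b - a)
    swapP-a a b x e with resN n x ℕ.≟ resN n a
    ... | yes _ = refl
    ... | no ne = ⊥-elim (ne e)

    swapP-b : ∀ a b x → resN n x ≢ resN n a → resN n x ≡ resN n b → swapP n a b x ≡ x - (b - a)
    swapP-b a b x ne e with resN n x ℕ.≟ resN n a
    ... | yes e' = ⊥-elim (ne e')
    ... | no _ with resN n x ℕ.≟ resN n b
    ...   | yes _ = refl
    ...   | no ne' = ⊥-elim (ne' e)

    swapP-other : ∀ a b x → resN n x ≢ resN n a → resN n x ≢ resN n b → swapP n a b x ≡ x
    swapP-other a b x ne ne2 with resN n x ℕ.≟ resN n a
    ... | yes e' = ⊥-elim (ne e')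
    ... | no _ with resN n x ℕ.≟ resN n b
    ...   | yes e' = ⊥-elim (ne2 e')
    ...   | no _ = refl

    data SwapCase (x a b : ℤ) : Set where
      at-a : resN n x ≡ resN n a → SwapCase x a b
      at-b : resN n x ≢ resN n a → resN n x ≡ resN n b → SwapCase x a b
      elsewhere : resN n x ≢ resN n a → resN n x ≢ resN n b → SwapCase x a b

    swapCase : ∀ x a b → SwapCase x a b
    swapCase x a b with resN n x ℕ.≟ resN n a
    ... | yes e = at-a e
    ... | no ne with resN n x ℕ.≟ resN n b
    ...   | yes e = at-b ne e
    ...   | no ne2 = elsewhere ne ne2

    swapP-periodic : ∀ a b x k → swapP n a b (x + k * Nℤ) ≡ swapP n a b x + k * Nℤ
    swapP-periodic a b x k = by-cases (swapCase x a b)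
      where
      l0 : ∀ (x d k m : ℤ) → x + d + k * m ≡ x + k * m + d
      l0 = solve-∀
      l1 : ∀ (x d k m : ℤ) → x - d + k * m ≡ x + k * m - d
      l1 = solve-∀
      by-cases : SwapCase x a b → swapP n a b (x + k * Nℤ) ≡ swapP n a b x + k * Nℤ
      by-cases (at-a e) = trans (swapP-a a b (x + k * Nℤ) (trans (resN-+multiple x k) e))
                    (trans (sym (l0 x (b - a) k Nℤ)) (cong (_+ k * Nℤ) (sym (swapP-a a b x e))))
      by-cases (at-b ne e) = trans (swapP-b a b (x + k * Nℤ) (λ q → ne (trans (sym (resN-+multiple x k)) q)) (trans (resN-+multiple x k) e))
                    (trans (sym (l1 x (b - a) k Nℤ)) (cong (_+ k * Nℤ) (sym (swapP-b a b x ne e))))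
      by-cases (elsewhere ne ne2) = trans (swapP-other a b (x + k * Nℤ) (λ q → ne (trans (sym (resN-+multiple x k)) q)) (λ q → ne2 (trans (sym (resN-+multiple x k)) q)))
                    (cong (_+ k * Nℤ) (sym (swapP-other a b x ne ne2)))

    resN-neg-swapʳ : ∀ x y → resN n x ≡ resN n (- y) → resN n (- x) ≡ resN n y
    resN-neg-swapʳ x y e = trans (resN-cong-neg x (- y) e) (cong (resN n) (ZP.neg-involutive y))

    resN-neg-swapˡ : ∀ x y → resN n (- x) ≡ resN n y → resN n x ≡ resN n (- y)
    resN-neg-swapˡ x y e = trans (cong (resN n) (sym (ZP.neg-involutive x))) (resN-cong-neg (- x) y e)

    swapP-neg : ∀ a b x → swapP n a b (- x) ≡ - swapP n (- a) (- b) x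
    swapP-neg a b x = by-cases (swapCase x (- a) (- b))
      where
      l0 : ∀ (x a b : ℤ) → - x + (b - a) ≡ - (x + (- b - - a))
      l0 = solve-∀
      l1 : ∀ (x a b : ℤ) → - x - (b - a) ≡ - (x - (- b - - a))
      l1 = solve-∀
      by-cases : SwapCase x (- a) (- b) → swapP n a b (- x) ≡ - swapP n (- a) (- b) x
      by-cases (at-a e) = trans (swapP-a a b (- x) (resN-neg-swapʳ x a e)) (trans (l0 x a b) (cong -_ (sym (swapP-a (- a) (- b) x e))))
      by-cases (at-b ne e) = trans (swapP-b a b (- x) (λ q → ne (resN-neg-swapˡ x a q)) (resN-neg-swapʳ x b e))
                       (trans (l1 x a b) (cong -_ (sym (swapP-b (- a) (- b) x ne e))))
      by-cases (elsewhere ne ne2) = trans (swapP-other a b (- x) (λ q → ne (resN-neg-swapˡ x a q)) (λ q → ne2 (resN-neg-swapˡ x b q)))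
                       (cong -_ (sym (swapP-other (- a) (- b) x ne ne2)))

    swapP-cong : ∀ a b a' b' x → resN n a ≡ resN n a' → resN n b ≡ resN n b' → b - a ≡ b' - a' →
                swapP n a b x ≡ swapP n a' b' x
    swapP-cong a b a' b' x ea eb ed = by-cases (swapCase x a b)
      where
      by-cases : SwapCase x a b → swapP n a b x ≡ swapP n a' b' x
      by-cases (at-a e) = trans (swapP-a a b x e) (trans (cong (_+_ x) ed) (sym (swapP-a a' b' x (trans e ea))))
      by-cases (at-b ne e) = trans (swapP-b a b x ne e) (trans (cong (_-_ x) ed)
                       (sym (swapP-b a' b' x (λ q → ne (trans q (sym ea))) (trans e eb))))
      by-cases (elsewhere ne ne2) = trans (swapP-other a b x ne ne2) (sym (swapP-other a' b' x (λ q → ne (trans q (sym ea))) (λ q → ne2 (trans q (sym eb)))))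

    swapP-sym : ∀ a b x → resN n a ≢ resN n b → swapP n a b x ≡ swapP n b a x
    swapP-sym a b x dab = by-cases (swapCase x a b)
      where
      l0 : ∀ (x a b : ℤ) → x + (b - a) ≡ x - (a - b)
      l0 = solve-∀
      l1 : ∀ (x a b : ℤ) → x - (b - a) ≡ x + (a - b)
      l1 = solve-∀
      by-cases : SwapCase x a b → swapP n a b x ≡ swapP n b a x
      by-cases (at-a e) = trans (swapP-a a b x e) (trans (l0 x a b) (sym (swapP-b b a x (λ q → dab (trans (sym e) q)) e)))
      by-cases (at-b ne e) = trans (swapP-b a b x ne e) (trans (l1 x a b) (sym (swapP-a b a x e)))
      by-cases (elsewhere ne ne2) = trans (swapP-other a b x ne ne2) (sym (swapP-other b a x ne2 ne))

    swapP-involutive : ∀ a b x → resN n a ≢ resN n b → swapP n a b (swapP n a b x) ≡ x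
    swapP-involutive a b x dab = by-cases (swapCase x a b)
      where
      l0 : ∀ (x a b : ℤ) → x + (b - a) - (b - a) ≡ x
      l0 = solve-∀
      l1 : ∀ (x a b : ℤ) → x - (b - a) ≡ x + (a - b)
      l1 = solve-∀
      l2 : ∀ (x a b : ℤ) → x + (a - b) + (b - a) ≡ x
      l2 = solve-∀
      by-cases : SwapCase x a b → swapP n a b (swapP n a b x) ≡ x
      by-cases (at-a e) = trans (cong (swapP n a b) (swapP-a a b x e))
        (trans (swapP-b a b (x + (b - a)) (λ q → dab (trans (sym q) (resN-translate x a b e))) (resN-translate x a b e)) (l0 x a b))
      by-cases (at-b ne e) = trans (cong (swapP n a b) (trans (swapP-b a b x ne e) (l1 x a b)))
        (trans (swapP-a a b (x + (a - b)) (resN-translate x b a e)) (l2 x a b))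
      by-cases (elsewhere ne ne2) = trans (cong (swapP n a b) (swapP-other a b x ne ne2)) (swapP-other a b x ne ne2)

    swapP-comm : ∀ a b c d x → resN n a ≢ resN n c → resN n a ≢ resN n d → resN n b ≢ resN n c → resN n b ≢ resN n d →
       swapP n a b (swapP n c d x) ≡ swapP n c d (swapP n a b x)
    swapP-comm a b c d x ac ad bc bd = by-cases (swapCase x c d) (swapCase x a b)
      where
      l1 : ∀ (x c d : ℤ) → x - (d - c) ≡ x + (c - d)
      l1 = solve-∀
      by-cases : SwapCase x c d → SwapCase x a b → swapP n a b (swapP n c d x) ≡ swapP n c d (swapP n a b x)
      by-cases (at-a e) (at-a e') = ⊥-elim (ac (trans (sym e') e))
      by-cases (at-a e) (at-b _ e') = ⊥-elim (bc (trans (sym e') e))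
      by-cases (at-b _ e) (at-a e') = ⊥-elim (ad (trans (sym e') e))
      by-cases (at-b _ e) (at-b _ e') = ⊥-elim (bd (trans (sym e') e))
      by-cases (at-a e) (elsewhere ne ne2) = trans (cong (swapP n a b) (swapP-a c d x e))
        (trans (swapP-other a b (x + (d - c)) (λ q → ad (trans (sym q) (resN-translate x c d e))) (λ q → bd (trans (sym q) (resN-translate x c d e))))
        (trans (sym (swapP-a c d x e)) (cong (swapP n c d) (sym (swapP-other a b x ne ne2)))))
      by-cases (at-b ne0 e) (elsewhere ne ne2) = trans (cong (swapP n a b) (trans (swapP-b c d x ne0 e) (l1 x c d)))
        (trans (swapP-other a b (x + (c - d)) (λ q → ac (trans (sym q) (resN-translate x d c e))) (λ q → bc (trans (sym q) (resN-translate x d c e))))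
        (trans (sym (l1 x c d)) (trans (sym (swapP-b c d x ne0 e)) (cong (swapP n c d) (sym (swapP-other a b x ne ne2))))))
      by-cases (elsewhere ne ne2) (at-a e') = trans (cong (swapP n a b) (swapP-other c d x ne ne2))
        (trans (swapP-a a b x e')
        (trans (sym (swapP-other c d (x + (b - a)) (λ q → bc (trans (sym (resN-translate x a b e')) q)) (λ q → bd (trans (sym (resN-translate x a b e')) q))))
        (cong (swapP n c d) (sym (swapP-a a b x e')))))
      by-cases (elsewhere ne ne2) (at-b ne0 e') = trans (cong (swapP n a b) (swapP-other c d x ne ne2))
        (trans (trans (swapP-b a b x ne0 e') (l1 x a b))
        (trans (sym (swapP-other c d (x + (a - b)) (λ q → ac (trans (sym (resN-translate x b a e')) q)) (λ q → ad (trans (sym (resN-translate x b a e')) q))))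
          (cong (swapP n c d) (trans (sym (l1 x a b)) (sym (swapP-b a b x ne0 e'))))))
      by-cases (elsewhere ne ne2) (elsewhere ne' ne2') = trans (cong (swapP n a b) (swapP-other c d x ne ne2))
        (trans (swapP-other a b x ne' ne2') (trans (sym (swapP-other c d x ne ne2)) (cong (swapP n c d) (sym (swapP-other a b x ne' ne2')))))

  module _ (n : ℕ) where
    Nℤ≡2+2n : + N n ≡ + 2 + + 2 * + n
    Nℤ≡2+2n = trans (ZP.pos-+ 2 (2 ℕ.* n)) (cong (_+_ (+ 2)) (ZP.pos-* 2 n))

    gen-s₀ : (i : Fin (suc n)) → toℕ i ≡ 0 → ∀ x → gen n i x ≡ swapP n -[1+ 0 ] (+ 1) x
    gen-s₀ i eq x with toℕ i
    ... | zero = refl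
    ... | suc k = ⊥-elim (case eq of λ ())

  gen-sₙ : (n : ℕ) (i : Fin (suc n)) → toℕ i ≡ n → 1 ℕ.≤ n → ∀ x → gen n i x ≡ swapP n (+ n) (+ (n ℕ.+ 2)) x
  gen-sₙ n i eq p x with toℕ i
  gen-sₙ (suc n) i refl p x | .(suc n) with suc n ℕ.≟ suc n
  ... | yes _ = refl
  ... | no q = ⊥-elim (q refl)

  gen-sₖ : (n : ℕ) (i : Fin (suc n)) (k : ℕ) → toℕ i ≡ suc k → suc k ≢ n → ∀ x →
     gen n i x ≡ swapP n (+ suc k) (+ suc (suc k)) (swapP n (- (+ suc k)) (- (+ suc (suc k))) x)
  gen-sₖ n i k eq ne x with toℕ i
  gen-sₖ n i k refl ne x | .(suc k) with suc k ℕ.≟ n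
  ... | yes e = ⊥-elim (ne e)
  ... | no _ = refl

  module _ (n : ℕ) where
    resN-neg+m≡N : ∀ m → 0 ℕ.< m → m ℕ.< N n → resN n (- + m) ℕ.+ m ≡ N n
    resN-neg+m≡N m p q = trans (cong (ℕ._+ m) rr) (NP.m∸n+n≡m (NP.<⇒≤ q))
      where
      e1 : + (N n ℕ.∸ m) ≡ + N n - + m
      e1 = trans (sym (ZP.≤-⊖ (NP.<⇒≤ q))) (sym (ZP.m-n≡m⊖n (N n) m))
      l : ∀ (a b : ℤ) → - b ≡ (a - b) + (- + 1) * a
      l = solve-∀
      rr : resN n (- + m) ≡ N n ℕ.∸ m
      rr = proj₁ (divMod-unique (N n) (- + m) (N n ℕ.∸ m) (- + 1) (NP.∸-monoʳ-< {o = 0} p (NP.<⇒≤ q))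
            (trans (l (+ N n) (+ m)) (cong (λ z → z + (- + 1) * + N n) (sym e1))))

    n<N : n ℕ.< N n
    n<N = subst (n ℕ.<_) (sym (N≡2+[n+n] n)) (s≤s (NP.≤-trans (NP.m≤m+n n n) (NP.n≤1+n _)))

    resN-≤n : ∀ m → m ℕ.≤ n → resN n (+ m) ≡ m
    resN-≤n m le = resN-small n m (NP.≤-<-trans le n<N)

    resN-neg≥n+2 : ∀ m → 0 ℕ.< m → m ℕ.≤ n → suc (suc n) ℕ.≤ resN n (- + m)
    resN-neg≥n+2 m p le = NP.+-cancelʳ-≤ n (suc (suc n)) (resN n (- + m)) le2
      where
      e = resN-neg+m≡N m p (NP.≤-<-trans le n<N)
      le2 : suc (suc n) ℕ.+ n ℕ.≤ resN n (- + m) ℕ.+ n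
      le2 = subst (ℕ._≤ resN n (- + m) ℕ.+ n) (N≡2+[n+n] n)
                  (NP.≤-trans (NP.≤-reflexive (sym e)) (NP.+-monoʳ-≤ (resN n (- + m)) le))

    resN-neg-injective : ∀ a b → 0 ℕ.< a → a ℕ.< N n → 0 ℕ.< b → b ℕ.< N n → resN n (- + a) ≡ resN n (- + b) → a ≡ b
    resN-neg-injective a b pa qa pb qb e = NP.+-cancelˡ-≡ (resN n (- + a)) a b
       (trans (resN-neg+m≡N a pa qa) (trans (sym (resN-neg+m≡N b pb qb)) (cong (ℕ._+ b) (sym e))))

    resN-pos≢neg : ∀ a m → a ℕ.≤ n → 0 ℕ.< m → m ℕ.≤ n → resN n (+ a) ≢ resN n (- + m)
    resN-pos≢neg a m la pm lm e = NP.<-irrefl refl (NP.<-≤-trans (s≤s (NP.≤-trans la (NP.n≤1+n n)))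
          (NP.≤-trans (resN-neg≥n+2 m pm lm) (NP.≤-reflexive (sym (trans (sym (resN-≤n a la)) e)))))

  -- The generators as periodic odd involutions

  module _ (n : ℕ) (1≤n : 1 ℕ.≤ n) where
    data GenView (i : Fin (suc n)) : Set where
      is-s₀ : toℕ i ≡ 0 → GenView i
      is-sₙ : toℕ i ≡ n → GenView i
      is-sₖ : (k : ℕ) → toℕ i ≡ suc k → suc (suc k) ℕ.≤ n → GenView i

    genView : ∀ i → GenView i
    genView i with toℕ i in eq
    ... | zero = is-s₀ eq
    ... | suc k with suc k ℕ.≟ n
    ...   | yes e = is-sₙ (trans eq e)
    ...   | no ne = is-sₖ k eq (NP.≤∧≢⇒< (subst (ℕ._≤ n) eq (Data.Fin.Properties.toℕ≤pred[n] i)) ne)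

    private
      n2<N : n ℕ.+ 2 ℕ.< N n
      n2<N = subst (n ℕ.+ 2 ℕ.<_) (sym (N≡n+2+n n)) (NP.m<m+n (n ℕ.+ 2) 1≤n)

    resN-1 : resN n (+ 1) ≡ 1
    resN-1 = resN-≤n n 1 1≤n
    resN-−1≢1 : resN n (- + 1) ≢ resN n (+ 1)
    resN-−1≢1 e = resN-pos≢neg n 1 1 1≤n (s≤s z≤n) 1≤n (sym e)
    resN-n : resN n (+ n) ≡ n
    resN-n = resN-≤n n n NP.≤-refl
    resN-n+2 : resN n (+ (n ℕ.+ 2)) ≡ n ℕ.+ 2
    resN-n+2 = resN-small n (n ℕ.+ 2) n2<N
    resN-n≢n+2 : resN n (+ n) ≢ resN n (+ (n ℕ.+ 2))
    resN-n≢n+2 e = case NP.+-cancelˡ-≡ n 0 2 (trans (NP.+-identityʳ n) (trans (sym resN-n) (trans e resN-n+2))) of λ ()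
    resN-−n : resN n (- + n) ≡ resN n (+ (n ℕ.+ 2))
    resN-−n = trans (NP.+-cancelʳ-≡ n _ _ (trans (resN-neg+m≡N n n 1≤n (n<N n)) (N≡n+2+n n))) (sym resN-n+2)
    resN-−[n+2] : resN n (- + (n ℕ.+ 2)) ≡ resN n (+ n)
    resN-−[n+2] = trans (NP.+-cancelʳ-≡ (n ℕ.+ 2) _ _ (trans (resN-neg+m≡N n (n ℕ.+ 2) (subst (0 ℕ.<_) (NP.+-comm 2 n) (s≤s z≤n)) n2<N) (N≡n+[n+2] n))) (sym resN-n)

    module Sₖ (k : ℕ) (k+2≤n : suc (suc k) ℕ.≤ n) where
      k+1≤n : suc k ℕ.≤ n
      k+1≤n = NP.≤-trans (NP.n≤1+n (suc k)) k+2≤n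
      a≢b : resN n (+ suc k) ≢ resN n (+ suc (suc k))
      a≢b e = NP.<-irrefl refl (subst (suc k ℕ.<_) (sym (trans (sym (resN-≤n n (suc k) k+1≤n)) (trans e (resN-≤n n (suc (suc k)) k+2≤n)))) NP.≤-refl)
      c≢d : resN n (- + suc k) ≢ resN n (- + suc (suc k))
      c≢d e = NP.<-irrefl refl (subst (suc k ℕ.<_) (sym (resN-neg-injective n (suc k) (suc (suc k)) (s≤s z≤n) (NP.≤-<-trans k+1≤n (n<N n)) (s≤s z≤n) (NP.≤-<-trans k+2≤n (n<N n)) e)) NP.≤-refl)
      pn : ∀ a m → a ℕ.≤ n → suc m ℕ.≤ n → resN n (- + suc m) ≢ resN n (+ a)
      pn a m la lm e = resN-pos≢neg n a (suc m) la (s≤s z≤n) lm (sym e)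

      O I : ℤ → ℤ
      O = swapP n (+ suc k) (+ suc (suc k))
      I = swapP n (- + suc k) (- + suc (suc k))

      comm : ∀ x → I (O x) ≡ O (I x)
      comm x = swapP-comm n (- + suc k) (- + suc (suc k)) (+ suc k) (+ suc (suc k)) x
        (pn (suc k) k k+1≤n k+1≤n) (pn (suc (suc k)) k k+2≤n k+1≤n) (pn (suc k) (suc k) k+1≤n k+2≤n) (pn (suc (suc k)) (suc k) k+2≤n k+2≤n)

    suc≢n : ∀ k → suc (suc k) ℕ.≤ n → suc k ≢ n
    suc≢n k k+2≤n e = NP.<-irrefl e k+2≤n

    gen-periodic : ∀ i x k → gen n i (x + k * Nℤ n) ≡ gen n i x + k * Nℤ n
    gen-periodic i x k with genView i
    ... | is-s₀ e = trans (gen-s₀ n i e (x + k * Nℤ n)) (trans (swapP-periodic n -[1+ 0 ] (+ 1) x k) (cong (_+ k * Nℤ n) (sym (gen-s₀ n i e x))))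
    ... | is-sₙ e = trans (gen-sₙ n i e 1≤n (x + k * Nℤ n)) (trans (swapP-periodic n (+ n) (+ (n ℕ.+ 2)) x k) (cong (_+ k * Nℤ n) (sym (gen-sₙ n i e 1≤n x))))
    ... | is-sₖ k' e k+2≤n = trans (gen-sₖ n i k' e (suc≢n k' k+2≤n) (x + k * Nℤ n))
          (trans (cong (Sₖ.O k' k+2≤n) (swapP-periodic n (- + suc k') (- + suc (suc k')) x k))
          (trans (swapP-periodic n (+ suc k') (+ suc (suc k')) (Sₖ.I k' k+2≤n x) k) (cong (_+ k * Nℤ n) (sym (gen-sₖ n i k' e (suc≢n k' k+2≤n) x)))))

    gen-odd : ∀ i x → gen n i (- x) ≡ - gen n i x
    gen-odd i x with genView i
    ... | is-s₀ e = trans (gen-s₀ n i e (- x)) (trans (swapP-neg n -[1+ 0 ] (+ 1) x) (cong -_ (trans (swapP-sym n (+ 1) -[1+ 0 ] x (λ q → resN-−1≢1 (sym q))) (sym (gen-s₀ n i e x)))))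
    ... | is-sₙ e = trans (gen-sₙ n i e 1≤n (- x)) (trans (swapP-neg n (+ n) (+ (n ℕ.+ 2)) x) (cong -_ (trans
           (swapP-cong n (- + n) (- + (n ℕ.+ 2)) (+ (n ℕ.+ 2)) (+ n) x resN-−n resN-−[n+2] (l (+ n) (+ (n ℕ.+ 2))))
           (trans (swapP-sym n (+ (n ℕ.+ 2)) (+ n) x (λ q → resN-n≢n+2 (sym q))) (sym (gen-sₙ n i e 1≤n x))))))
      where
      l : ∀ (a b : ℤ) → - b - - a ≡ a - b
      l = solve-∀
    ... | is-sₖ k' e k+2≤n = trans (gen-sₖ n i k' e (suc≢n k' k+2≤n) (- x))
          (trans (cong (Sₖ.O k' k+2≤n) (swapP-neg n (- + suc k') (- + suc (suc k')) x))
          (trans (swapP-neg n (+ suc k') (+ suc (suc k')) (Sₖ.O k' k+2≤n x))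
          (cong -_ (trans (Sₖ.comm k' k+2≤n x) (sym (gen-sₖ n i k' e (suc≢n k' k+2≤n) x))))))

    gen-involutive : ∀ i x → gen n i (gen n i x) ≡ x
    gen-involutive i x with genView i
    ... | is-s₀ e = trans (gen-s₀ n i e (gen n i x)) (trans (cong (swapP n -[1+ 0 ] (+ 1)) (gen-s₀ n i e x)) (swapP-involutive n -[1+ 0 ] (+ 1) x resN-−1≢1))
    ... | is-sₙ e = trans (gen-sₙ n i e 1≤n (gen n i x)) (trans (cong (swapP n (+ n) (+ (n ℕ.+ 2))) (gen-sₙ n i e 1≤n x)) (swapP-involutive n (+ n) (+ (n ℕ.+ 2)) x resN-n≢n+2))
    ... | is-sₖ k' e k+2≤n = trans (gen-sₖ n i k' e (suc≢n k' k+2≤n) (gen n i x))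
          (trans (cong (λ z → Sₖ.O k' k+2≤n (Sₖ.I k' k+2≤n z)) (gen-sₖ n i k' e (suc≢n k' k+2≤n) x))
          (trans (cong (Sₖ.O k' k+2≤n) (Sₖ.comm k' k+2≤n (Sₖ.I k' k+2≤n x)))
          (trans (swapP-involutive n (+ suc k') (+ suc (suc k')) (Sₖ.I k' k+2≤n (Sₖ.I k' k+2≤n x)) (Sₖ.a≢b k' k+2≤n)) (swapP-involutive n (- + suc k') (- + suc (suc k')) x (Sₖ.c≢d k' k+2≤n)))))

  module _ (n : ℕ) (1≤n : 1 ℕ.≤ n) where
    eval-periodic : ∀ u x k → eval n u (x + k * Nℤ n) ≡ eval n u x + k * Nℤ n
    eval-periodic [] x k = refl
    eval-periodic (i ∷ u) x k = trans (cong (gen n i) (eval-periodic u x k)) (gen-periodic n 1≤n i (eval n u x) k)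

    eval-odd : ∀ u x → eval n u (- x) ≡ - eval n u x
    eval-odd [] x = refl
    eval-odd (i ∷ u) x = trans (cong (gen n i) (eval-odd u x)) (gen-odd n 1≤n i (eval n u x))

    eval-++ : ∀ u v x → eval n (u ++ v) x ≡ eval n u (eval n v x)
    eval-++ [] v x = refl
    eval-++ (i ∷ u) v x = cong (gen n i) (eval-++ u v x)

    eval-reverse-∷ : ∀ i u x → eval n (reverse (i ∷ u)) x ≡ eval n (reverse u) (gen n i x)
    eval-reverse-∷ i u x = trans (cong (λ l → eval n l x) (LP.unfold-reverse i u)) (eval-++ (reverse u) [ i ] x)

    eval-reverse-inverseˡ : ∀ u x → eval n (reverse u) (eval n u x) ≡ x
    eval-reverse-inverseˡ [] x = refl
    eval-reverse-inverseˡ (i ∷ u) x = trans (eval-reverse-∷ i u (gen n i (eval n u x)))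
       (trans (cong (eval n (reverse u)) (gen-involutive n 1≤n i (eval n u x))) (eval-reverse-inverseˡ u x))

    eval-reverse-inverseʳ : ∀ u x → eval n u (eval n (reverse u) x) ≡ x
    eval-reverse-inverseʳ u x = trans (cong (λ l → eval n l (eval n (reverse u) x)) (sym (LP.reverse-involutive u))) (eval-reverse-inverseˡ (reverse u) x)

    module OddPeriodic (f g : ℤ → ℤ) (fE : ∀ x k → f (x + k * Nℤ n) ≡ f x + k * Nℤ n) (fN : ∀ x → f (- x) ≡ - f x)
              (gf : ∀ x → g (f x) ≡ x) where
      injective : ∀ a b → f a ≡ f b → a ≡ b
      injective a b e = trans (sym (gf a)) (trans (cong g e) (gf b))

      small≡ : ∀ a b → 1 ℕ.≤ a → a ℕ.≤ n → 1 ℕ.≤ b → b ℕ.≤ n → resN n (+ a) ≡ resN n (+ b) → a ≡ b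
      small≡ a b _ la _ lb e = trans (sym (resN-≤n n a la)) (trans e (resN-≤n n b lb))

      res-injective : ∀ a b → 1 ℕ.≤ a → a ℕ.≤ n → 1 ℕ.≤ b → b ℕ.≤ n → resN n (f (+ a)) ≡ resN n (f (+ b)) → a ≡ b
      res-injective a b pa la pb lb e = small≡ a b pa la pb lb (sym (trans (cong (resN n) e2) (resN-+multiple n (+ a) k)))
        where
        k = quoN n (f (+ b)) - quoN n (f (+ a))
        e1 : f (+ b) ≡ f (+ a + k * Nℤ n)
        e1 = trans (resN≡⇒+multiple n (f (+ a)) (f (+ b)) e) (sym (fE (+ a) k))
        e2 : + b ≡ + a + k * Nℤ n
        e2 = injective (+ b) (+ a + k * Nℤ n) e1

      res≢res-neg : ∀ a b → 1 ℕ.≤ a → a ℕ.≤ n → 1 ℕ.≤ b → b ℕ.≤ n → resN n (f (+ a)) ≢ resN n (- f (+ b))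
      res≢res-neg a b pa la pb lb e = resN-pos≢neg n a b la pb lb (sym (trans (cong (resN n) e2) (resN-+multiple n (+ a) k)))
        where
        k = quoN n (- f (+ b)) - quoN n (f (+ a))
        e1 : f (- + b) ≡ f (+ a + k * Nℤ n)
        e1 = trans (fN (+ b)) (trans (resN≡⇒+multiple n (f (+ a)) (- f (+ b)) e) (sym (fE (+ a) k)))
        e2 : - + b ≡ + a + k * Nℤ n
        e2 = injective (- + b) (+ a + k * Nℤ n) e1

  -- Inversion counts

  module _ (n : ℕ) where
    quoN-+multiple : ∀ x k → quoN n (x + k * Nℤ n) ≡ quoN n x + k
    quoN-+multiple x k = proj₂ (divModN-+multiple n x k)

    quoN-neg : ∀ y → resN n y ≢ 0 → quoN n (- y) ≡ - quoN n y - + 1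
    quoN-neg y nz = proj₂ (divMod-unique (N n) (- y) (N n ℕ.∸ r) (- q - + 1) (NP.∸-monoʳ-< {o = 0} r>0 (NP.<⇒≤ (resN<N n y))) eq)
      where
      r = resN n y
      q = quoN n y
      r>0 : 0 ℕ.< r
      r>0 = NP.n≢0⇒n>0 nz
      e1 : + (N n ℕ.∸ r) ≡ + N n - + r
      e1 = trans (sym (ZP.≤-⊖ (NP.<⇒≤ (resN<N n y)))) (sym (ZP.m-n≡m⊖n (N n) r))
      l : ∀ (r q m : ℤ) → - (r + q * m) ≡ (m - r) + (- q - + 1) * m
      l = solve-∀
      eq : - y ≡ + (N n ℕ.∸ r) + (- q - + 1) * Nℤ n
      eq = trans (cong -_ (resN+quoN*N n y)) (trans (l (+ r) q (Nℤ n)) (cong (λ z → z + (- q - + 1) * Nℤ n) (sym e1)))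

    quoN-neg-divisible : ∀ y → resN n y ≡ 0 → quoN n (- y) ≡ - quoN n y
    quoN-neg-divisible y z = proj₂ (divMod-unique (N n) (- y) 0 (- quoN n y) (s≤s z≤n) eq)
      where
      l : ∀ (q m : ℤ) → - (+ 0 + q * m) ≡ + 0 + (- q) * m
      l = solve-∀
      eq : - y ≡ + 0 + (- quoN n y) * Nℤ n
      eq = trans (cong -_ (trans (resN+quoN*N n y) (cong (λ w → + w + quoN n y * Nℤ n) z))) (l (quoN n y) (Nℤ n))

    ∣quoN∣ : ℤ → ℕ
    ∣quoN∣ x = ℤ.∣ quoN n x ∣

    ∣-q-1∣≤1+∣q∣ : ∀ q → ℤ.∣ - q - + 1 ∣ ℕ.≤ suc ℤ.∣ q ∣
    ∣-q-1∣≤1+∣q∣ (+ zero) = NP.≤-refl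
    ∣-q-1∣≤1+∣q∣ (+ suc m) = NP.≤-reflexive (cong (λ z → suc (suc z)) (NP.+-identityʳ m))
    ∣-q-1∣≤1+∣q∣ -[1+ m ] = NP.≤-trans (NP.n≤1+n m) (NP.n≤1+n _)

    ∣quoN∣-neg≤ : ∀ d → ∣quoN∣ (- d) ℕ.≤ suc (∣quoN∣ d)
    ∣quoN∣-neg≤ d with resN n d ℕ.≟ 0
    ... | yes z = NP.≤-trans (NP.≤-reflexive (trans (cong ℤ.∣_∣ (quoN-neg-divisible d z)) (ZP.∣-i∣≡∣i∣ (quoN n d)))) (NP.n≤1+n _)
    ... | no nz = subst (ℕ._≤ suc (∣quoN∣ d)) (cong ℤ.∣_∣ (sym (quoN-neg d nz))) (∣-q-1∣≤1+∣q∣ (quoN n d))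

    quoN-negative : ∀ d → d < + 0 → Σ ℕ λ m → quoN n d ≡ -[1+ m ]
    quoN-negative d dn with quoN n d in eq
    ... | -[1+ m ] = m , refl
    ... | + m = ⊥-elim (contra (trans (resN+quoN*N n d) (trans (cong (λ z → + resN n d + z * Nℤ n) eq)
                  (trans (cong (_+_ (+ resN n d)) (sym (ZP.pos-* m (N n)))) (sym (ZP.pos-+ (resN n d) (m ℕ.* N n)))))))
      where
      contra : d ≡ + (resN n d ℕ.+ m ℕ.* N n) → ⊥
      contra e with subst (_< + 0) e dn
      ... | +<+ ()

    quoN-≥N : ∀ y → Nℤ n ≤ y → Σ ℕ λ m → quoN n y ≡ + suc m
    quoN-≥N y le with quoN n y in eq
    ... | + suc m = m , refl
    ... | + zero = ⊥-elim (NP.<-irrefl refl (NP.<-≤-trans (resN<N n y) (drop (subst (Nℤ n ≤_) e0 le))))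
      where
      e0 : y ≡ + resN n y
      e0 = trans (resN+quoN*N n y) (trans (cong (λ z → + resN n y + z * Nℤ n) eq) (ZP.+-identityʳ (+ resN n y)))
      drop : ∀ {a b} → + a ≤ + b → a ℕ.≤ b
      drop (+≤+ p) = p
    ... | -[1+ m ] = ⊥-elim (neg (subst (Nℤ n ≤_) e0 le))
      where
      l : ∀ (r k m : ℤ) → r + (- k) * m ≡ r - k * m
      l = solve-∀
      e0 : y ≡ + resN n y - + (suc m ℕ.* N n)
      e0 = trans (resN+quoN*N n y) (trans (cong (λ z → + resN n y + z * Nℤ n) eq)
            (trans (l (+ resN n y) (+ suc m) (Nℤ n)) (cong (λ z → + resN n y - z) (sym (ZP.pos-* (suc m) (N n))))))
      neg : Nℤ n ≤ + resN n y - + (suc m ℕ.* N n) → ⊥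
      neg p = NP.<-irrefl refl (NP.<-≤-trans (resN<N n y) (NP.≤-trans (NP.m≤m+n (N n) (suc m ℕ.* N n)) p3))
        where
        p2 : Nℤ n + + (suc m ℕ.* N n) ≤ + resN n y
        p2 = subst (Nℤ n + + (suc m ℕ.* N n) ≤_) (l2 (+ resN n y) (+ (suc m ℕ.* N n))) (ZP.+-monoˡ-≤ (+ (suc m ℕ.* N n)) p)
          where
          l2 : ∀ (a b : ℤ) → a - b + b ≡ a
          l2 = solve-∀
        p3 : N n ℕ.+ suc m ℕ.* N n ℕ.≤ resN n y
        p3 with subst (_≤ + resN n y) (sym (ZP.pos-+ (N n) (suc m ℕ.* N n))) p2
        ... | +≤+ q = q

    ∣quoN∣-neg-negative : ∀ d → resN n d ≢ 0 → d < + 0 → suc (∣quoN∣ (- d)) ≡ ∣quoN∣ d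
    ∣quoN∣-neg-negative d nz dn with quoN-negative d dn
    ... | m , eq = trans (cong (λ z → suc ℤ.∣ z ∣) (trans (quoN-neg d nz) (cong (λ z → - z - + 1) eq))) (cong ℤ.∣_∣ (sym eq))

    ∣quoN∣-reflect : ∀ y → resN n y ≢ 0 → ∣quoN∣ (- y + Nℤ n) ≡ ∣quoN∣ y
    ∣quoN∣-reflect y nz = trans (cong ℤ.∣_∣ (trans (cong (quoN n) (sym (l (- y) (Nℤ n)))) (trans (quoN-+multiple (- y) (+ 1)) (trans (cong (_+ + 1) (quoN-neg y nz)) (l2 (quoN n y))))))
                (ZP.∣-i∣≡∣i∣ (quoN n y))
      where
      l : ∀ (a m : ℤ) → a + + 1 * m ≡ a + m
      l = solve-∀
      l2 : ∀ (q : ℤ) → - q - + 1 + + 1 ≡ - q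
      l2 = solve-∀

    pointInv : ℤ → ℕ
    pointInv p = ∣quoN∣ (p + + suc n)

    +suc≡1+ : + suc n ≡ + 1 + + n
    +suc≡1+ = ZP.pos-+ 1 n

    pointInv-neg : ∀ p → resN n (p + + suc n) ≢ 0 → pointInv (- p) ≡ pointInv p
    pointInv-neg p nz = trans (cong ∣quoN∣ e) (∣quoN∣-reflect (p + + suc n) nz)
      where
      l : ∀ (p n : ℤ) → - p + (+ 1 + n) ≡ - (p + (+ 1 + n)) + (+ 2 + + 2 * n)
      l = solve-∀
      e : - p + + suc n ≡ - (p + + suc n) + Nℤ n
      e = trans (cong (_+_ (- p)) +suc≡1+) (trans (l p (+ n)) (cong₂ (λ a b → - (p + a) + b) (sym +suc≡1+) (sym (Nℤ≡2+2n n))))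

    ∣1-q∣≤1+∣q∣ : ∀ q → ℤ.∣ - q - + 1 + + 2 ∣ ℕ.≤ suc ℤ.∣ q ∣
    ∣1-q∣≤1+∣q∣ (+ zero) = s≤s z≤n
    ∣1-q∣≤1+∣q∣ (+ suc zero) = z≤n
    ∣1-q∣≤1+∣q∣ (+ suc (suc m)) = NP.≤-trans (NP.≤-reflexive (cong suc (NP.+-identityʳ m))) (NP.≤-trans (NP.n≤1+n _) (NP.n≤1+n _))
    ∣1-q∣≤1+∣q∣ -[1+ m ] = NP.≤-reflexive (NP.+-comm m 2)

    reflect-+n+1 : ∀ p → (Nℤ n - p) + + suc n ≡ - (p + + suc n) + + 2 * Nℤ n
    reflect-+n+1 p = trans (cong₂ (λ a b → (a - p) + b) (Nℤ≡2+2n n) +suc≡1+) (trans (l p (+ n)) (cong₂ (λ a b → - (p + a) + + 2 * b) (sym +suc≡1+) (sym (Nℤ≡2+2n n))))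
      where
      l : ∀ (p n : ℤ) → (+ 2 + + 2 * n - p) + (+ 1 + n) ≡ - (p + (+ 1 + n)) + + 2 * (+ 2 + + 2 * n)
      l = solve-∀

    pointInv-reflect : ∀ p → resN n (p + + suc n) ≢ 0 → pointInv (Nℤ n - p) ≡ ℤ.∣ - quoN n (p + + suc n) - + 1 + + 2 ∣
    pointInv-reflect p nz = cong ℤ.∣_∣ (trans (cong (quoN n) (reflect-+n+1 p)) (trans (quoN-+multiple (- (p + + suc n)) (+ 2)) (cong (_+ + 2) (quoN-neg (p + + suc n) nz))))

    pointInv-reflect-≤ : ∀ p → resN n (p + + suc n) ≢ 0 → pointInv (Nℤ n - p) ℕ.≤ suc (pointInv p)
    pointInv-reflect-≤ p nz = subst (ℕ._≤ suc (pointInv p)) (sym (pointInv-reflect p nz)) (∣1-q∣≤1+∣q∣ (quoN n (p + + suc n)))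

    pointInv-reflect-descent : ∀ p → + suc n < p → resN n (p + + suc n) ≢ 0 → suc (pointInv (Nℤ n - p)) ≡ pointInv p
    pointInv-reflect-descent p lt nz with quoN-≥N (p + + suc n) big
      where
      big : Nℤ n ≤ p + + suc n
      big = subst (_≤ p + + suc n) (sym e) (ZP.+-monoˡ-≤ (+ suc n) (ZP.<⇒≤ lt))
        where
        l : ∀ (n : ℤ) → + 2 + + 2 * n ≡ (+ 1 + n) + (+ 1 + n)
        l = solve-∀
        e : Nℤ n ≡ + suc n + + suc n
        e = trans (Nℤ≡2+2n n) (trans (l (+ n)) (cong (λ a → a + a) (sym +suc≡1+)))
    ... | m , eq = trans (cong suc (pointInv-reflect p nz)) (trans (cong (λ z → suc ℤ.∣ - z - + 1 + + 2 ∣) eq) (trans (cong suc (lm m)) (cong ℤ.∣_∣ (sym eq))))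
      where
      lm : ∀ m → ℤ.∣ - + suc m - + 1 + + 2 ∣ ≡ m
      lm m = trans (cong ℤ.∣_∣ (trans (cong (λ z → - z - + 1 + + 2) (ZP.pos-+ 1 m)) (l (+ m)))) (ZP.∣-i∣≡∣i∣ (+ m))
        where
        l : ∀ (m : ℤ) → - (+ 1 + m) - + 1 + + 2 ≡ - m
        l = solve-∀

    pairInv : ℤ → ℤ → ℕ
    pairInv a b = ∣quoN∣ (b - a) ℕ.+ ∣quoN∣ (a + b)

    pairInv-negˡ : ∀ a b → pairInv (- a) b ≡ pairInv a b
    pairInv-negˡ a b = trans (cong₂ ℕ._+_ (cong ∣quoN∣ (l1 a b)) (cong ∣quoN∣ (l2 a b))) (NP.+-comm (∣quoN∣ (a + b)) (∣quoN∣ (b - a)))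
      where
      l1 : ∀ (a b : ℤ) → b - - a ≡ a + b
      l1 = solve-∀
      l2 : ∀ (a b : ℤ) → - a + b ≡ b - a
      l2 = solve-∀

    pairInv-reflectʳ : ∀ a b → resN n (b - a) ≢ 0 → resN n (b + a) ≢ 0 → pairInv a (Nℤ n - b) ≡ pairInv a b
    pairInv-reflectʳ a b z1' z2 = trans (cong₂ ℕ._+_ (trans (cong ∣quoN∣ (l1 a b (Nℤ n))) (∣quoN∣-reflect (b + a) z2)) (trans (cong ∣quoN∣ (l2 a b (Nℤ n))) (∣quoN∣-reflect (b - a) z1')))
       (trans (NP.+-comm (∣quoN∣ (b + a)) (∣quoN∣ (b - a))) (cong (λ z → ∣quoN∣ (b - a) ℕ.+ ∣quoN∣ z) (ZP.+-comm b a)))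
      where
      l1 : ∀ (a b m : ℤ) → m - b - a ≡ - (b + a) + m
      l1 = solve-∀
      l2 : ∀ (a b m : ℤ) → a + (m - b) ≡ - (b - a) + m
      l2 = solve-∀

    pairInv-swap-≤ : ∀ a b → pairInv b a ℕ.≤ suc (pairInv a b)
    pairInv-swap-≤ a b = NP.+-mono-≤ (subst (λ z → ∣quoN∣ z ℕ.≤ suc (∣quoN∣ (b - a))) (l1 a b) (∣quoN∣-neg≤ (b - a))) (NP.≤-reflexive (cong ∣quoN∣ (ZP.+-comm b a)))
      where
      l1 : ∀ (a b : ℤ) → - (b - a) ≡ a - b
      l1 = solve-∀

    pairInv-swap-descent : ∀ a b → resN n (b - a) ≢ 0 → b < a → suc (pairInv b a) ≡ pairInv a b
    pairInv-swap-descent a b nz lt = cong₂ ℕ._+_ (trans (cong (λ z → suc (∣quoN∣ z)) (sym (l1 a b))) (∣quoN∣-neg-negative (b - a) nz dn)) (cong ∣quoN∣ (ZP.+-comm b a))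
      where
      l1 : ∀ (a b : ℤ) → - (b - a) ≡ a - b
      l1 = solve-∀
      dn : b - a < + 0
      dn = subst (_< + 0) (ZP.+-comm (- a) b) (subst (- a + b <_) (ZP.+-inverseˡ a) (ZP.+-monoʳ-< (- a) lt))

  -- The inverse window and how the generators act on it

  module _ (n : ℕ) (1≤n : 1 ℕ.≤ n) where
    gen-s₀-1 : ∀ i → toℕ i ≡ 0 → gen n i (+ 1) ≡ - + 1
    gen-s₀-1 i e = trans (gen-s₀ n i e (+ 1)) (swapP-b n -[1+ 0 ] (+ 1) (+ 1) (λ q → resN-−1≢1 n 1≤n (sym q)) refl)

    gen-s₀-fixes : ∀ i → toℕ i ≡ 0 → ∀ m → 2 ℕ.≤ m → m ℕ.≤ n → gen n i (+ m) ≡ + m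
    gen-s₀-fixes i e m p2 lm = trans (gen-s₀ n i e (+ m)) (swapP-other n -[1+ 0 ] (+ 1) (+ m) (resN-pos≢neg n m 1 lm (s≤s z≤n) 1≤n)
       (λ q → NP.<-irrefl (sym (trans (sym (resN-≤n n m lm)) (trans q (resN-1 n 1≤n)))) p2))

    gen-sₙ-n : ∀ i → toℕ i ≡ n → gen n i (+ n) ≡ + (n ℕ.+ 2)
    gen-sₙ-n i e = trans (gen-sₙ n i e 1≤n (+ n)) (trans (swapP-a n (+ n) (+ (n ℕ.+ 2)) (+ n) refl) (l (+ n) (+ (n ℕ.+ 2))))
      where
      l : ∀ (a b : ℤ) → a + (b - a) ≡ b
      l = solve-∀

    gen-sₙ-fixes : ∀ i → toℕ i ≡ n → ∀ m → m ℕ.< n → gen n i (+ m) ≡ + m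
    gen-sₙ-fixes i e m lm = trans (gen-sₙ n i e 1≤n (+ m)) (swapP-other n (+ n) (+ (n ℕ.+ 2)) (+ m)
       (λ q → NP.<-irrefl (trans (sym (resN-≤n n m (NP.<⇒≤ lm))) (trans q (resN-n n 1≤n))) lm)
       (λ q → NP.<-irrefl (trans (sym (resN-≤n n m (NP.<⇒≤ lm))) (trans q (resN-n+2 n 1≤n))) (NP.<-trans lm (NP.≤-trans (NP.n≤1+n (suc n)) (NP.≤-reflexive (NP.+-comm 2 n))))))

    gen-sₖ-window : ∀ i k → toℕ i ≡ suc k → (k+2≤n : suc (suc k) ℕ.≤ n) → ∀ t → t ℕ.< n → gen n i (+ suc t) ≡ + suc (transposeAt k t)
    gen-sₖ-window i k e k+2≤n t lt = trans (gen-sₖ n i k e (suc≢n n 1≤n k k+2≤n) (+ suc t))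
        (trans (cong (Sₖ.O n 1≤n k k+2≤n) (swapP-other n (- + suc k) (- + suc (suc k)) (+ suc t)
          (resN-pos≢neg n (suc t) (suc k) lt (s≤s z≤n) (Sₖ.k+1≤n n 1≤n k k+2≤n)) (resN-pos≢neg n (suc t) (suc (suc k)) lt (s≤s z≤n) k+2≤n)))
        (by-cases (t ℕ.≟ k) (t ℕ.≟ suc k)))
      where
      l1 : ∀ (a b : ℤ) → a + (b - a) ≡ b
      l1 = solve-∀
      l2 : ∀ (a b : ℤ) → b - (b - a) ≡ a
      l2 = solve-∀
      rt = resN-≤n n (suc t) lt
      by-cases : Dec (t ≡ k) → Dec (t ≡ suc k) → Sₖ.O n 1≤n k k+2≤n (+ suc t) ≡ + suc (transposeAt k t)
      by-cases (yes refl) _ = trans (swapP-a n (+ suc k) (+ suc (suc k)) (+ suc k) refl) (trans (l1 (+ suc k) (+ suc (suc k))) (cong (λ z → + suc z) (sym (transposeAt-k k))))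
      by-cases (no _) (yes refl) = trans (swapP-b n (+ suc k) (+ suc (suc k)) (+ suc (suc k)) (λ q → Sₖ.a≢b n 1≤n k k+2≤n (sym q)) refl)
         (trans (l2 (+ suc k) (+ suc (suc k))) (cong (λ z → + suc z) (sym (transposeAt-suc k))))
      by-cases (no a) (no b) = trans (swapP-other n (+ suc k) (+ suc (suc k)) (+ suc t)
          (λ q → a (NP.suc-injective (trans (sym rt) (trans q (resN-≤n n (suc k) (Sₖ.k+1≤n n 1≤n k k+2≤n))))))
          (λ q → b (NP.suc-injective (trans (sym rt) (trans q (resN-≤n n (suc (suc k)) k+2≤n))))))
         (cong (λ z → + suc z) (sym (transposeAt-other k t a b)))

    invWindow : List (Fin (suc n)) → ℕ → ℤ
    invWindow u t = eval n (reverse u) (+ suc t)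

    invWindow-s₀ : ∀ i u → toℕ i ≡ 0 → ∀ t → t ℕ.< n → invWindow (i ∷ u) t ≡ update 0 (- invWindow u 0) (invWindow u) t
    invWindow-s₀ i u e zero lt = trans (eval-reverse-∷ n 1≤n i u (+ 1)) (trans (cong (eval n (reverse u)) (gen-s₀-1 i e)) (eval-odd n 1≤n (reverse u) (+ 1)))
    invWindow-s₀ i u e (suc t) lt = trans (eval-reverse-∷ n 1≤n i u (+ suc (suc t))) (cong (eval n (reverse u)) (gen-s₀-fixes i e (suc (suc t)) (s≤s (s≤s z≤n)) lt))

    invWindow-sₖ : ∀ i u k → toℕ i ≡ suc k → (k+2≤n : suc (suc k) ℕ.≤ n) → ∀ t → t ℕ.< n → invWindow (i ∷ u) t ≡ swapAt k (invWindow u) t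
    invWindow-sₖ i u k e k+2≤n t lt = trans (eval-reverse-∷ n 1≤n i u (+ suc t)) (cong (eval n (reverse u)) (gen-sₖ-window i k e k+2≤n t lt))

    invWindow-sₙ : ∀ i u → toℕ i ≡ n → ∀ t → t ℕ.< n → invWindow (i ∷ u) t ≡ update (ℕ.pred n) (Nℤ n - invWindow u (ℕ.pred n)) (invWindow u) t
    invWindow-sₙ i u e t lt with t ℕ.≟ ℕ.pred n
    ... | yes refl = trans (eval-reverse-∷ n 1≤n i u (+ suc (ℕ.pred n)))
          (trans (cong (λ z → eval n (reverse u) (gen n i (+ z))) sn)
          (trans (cong (eval n (reverse u)) (gen-sₙ-n i e))
          (trans (cong (eval n (reverse u)) ee)
          (trans (eval-periodic n 1≤n (reverse u) (- + n) (+ 1))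
          (trans (cong (λ z → z + + 1 * Nℤ n) (eval-odd n 1≤n (reverse u) (+ n)))
          (trans (l3 (eval n (reverse u) (+ n)) (Nℤ n))
          (trans (cong (λ z → Nℤ n - eval n (reverse u) (+ z)) (sym sn)) (sym (update-here (ℕ.pred n) _ (invWindow u))))))))))
      where
      sn : suc (ℕ.pred n) ≡ n
      sn = NP.suc-pred n ⦃ ℕ.>-nonZero 1≤n ⦄
      l : ∀ (n : ℤ) → + 2 + n ≡ - n + + 1 * (+ 2 + + 2 * n)
      l = solve-∀
      ee : + (n ℕ.+ 2) ≡ - + n + + 1 * Nℤ n
      ee = trans (trans (cong +_ (NP.+-comm n 2)) (ZP.pos-+ 2 n)) (trans (l (+ n)) (cong (λ z → - + n + + 1 * z) (sym (Nℤ≡2+2n n))))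
      l3 : ∀ (x m : ℤ) → - x + + 1 * m ≡ m - x
      l3 = solve-∀
    ... | no ne = trans (eval-reverse-∷ n 1≤n i u (+ suc t)) (trans (cong (eval n (reverse u)) (gen-sₙ-fixes i e (suc t) lt'))
          (sym (update-other (ℕ.pred n) _ (invWindow u) t ne)))
      where
      lt' : suc t ℕ.< n
      lt' = NP.≤∧≢⇒< lt (λ q → ne (cong ℕ.pred q))

  module _ (n : ℕ) where
    resN-−≡0 : ∀ x y → resN n (x - y) ≡ 0 → resN n x ≡ resN n y
    resN-−≡0 x y z = trans (cong (resN n) e) (resN-+multiple n y (quoN n (x - y)))
      where
      l : ∀ (x y q m : ℤ) → x - y ≡ + 0 + q * m → x ≡ y + q * m
      l x y q m e = trans (l2 x y) (trans (cong (_+_ y) e) (cong (_+_ y) (ZP.+-identityˡ (q * m))))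
        where
        l2 : ∀ (x y : ℤ) → x ≡ y + (x - y)
        l2 = solve-∀
      e : x ≡ y + quoN n (x - y) * Nℤ n
      e = l x y (quoN n (x - y)) (Nℤ n) (trans (resN+quoN*N n (x - y)) (cong (λ w → + w + quoN n (x - y) * Nℤ n) z))

    resN-+≡0 : ∀ x y → resN n (x + y) ≡ 0 → resN n x ≡ resN n (- y)
    resN-+≡0 x y z = resN-−≡0 x (- y) (trans (cong (resN n) (cong (_+_ x) (ZP.neg-involutive y))) z)

    Nℤ≡[n+1]+[n+1] : Nℤ n ≡ + suc n + + suc n
    Nℤ≡[n+1]+[n+1] = trans (Nℤ≡2+2n n) (trans (l (+ n)) (cong (λ a → a + a) (sym (+suc≡1+ n))))
      where
      l : ∀ (n : ℤ) → + 2 + + 2 * n ≡ (+ 1 + n) + (+ 1 + n)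
      l = solve-∀

    resN-+[n+1]≡0 : ∀ x → resN n (x + + suc n) ≡ 0 → resN n x ≡ resN n (- x)
    resN-+[n+1]≡0 x z = sym (trans (cong (resN n) e) (resN-+multiple n x (+ 1 - + 2 * q)))
      where
      q = quoN n (x + + suc n)
      s = + suc n
      l0 : ∀ (x s : ℤ) → x + s - s ≡ x
      l0 = solve-∀
      ex : x ≡ q * Nℤ n - s
      ex = trans (sym (l0 x s)) (cong (_- s) (trans (resN+quoN*N n (x + s)) (trans (cong (λ w → + w + q * Nℤ n) z) (ZP.+-identityˡ (q * Nℤ n)))))
      l : ∀ (q s : ℤ) → - (q * (s + s) - s) ≡ (q * (s + s) - s) + (+ 1 - + 2 * q) * (s + s)
      l = solve-∀
      e : - x ≡ x + (+ 1 - + 2 * q) * Nℤ n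
      e = trans (cong -_ ex) (trans (cong (λ M → - (q * M - s)) Nℤ≡[n+1]+[n+1]) (trans (l q s)
            (trans (cong (λ M → (q * M - s) + (+ 1 - + 2 * q) * M) (sym Nℤ≡[n+1]+[n+1])) (cong (λ w → w + (+ 1 - + 2 * q) * Nℤ n) (sym ex)))))

  module _ (n : ℕ) (1≤n : 1 ℕ.≤ n) where
    module InvWindow (u : List (Fin (suc n))) where
      open OddPeriodic n 1≤n (eval n (reverse u)) (eval n u) (eval-periodic n 1≤n (reverse u)) (eval-odd n 1≤n (reverse u)) (eval-reverse-inverseʳ n 1≤n u) public
      P : ℕ → ℤ
      P = invWindow n 1≤n u

      invWindow-−-res≢0 : ∀ t t' → t ℕ.< n → t' ℕ.< n → t ≢ t' → resN n (P t' - P t) ≢ 0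
      invWindow-−-res≢0 t t' lt lt' ne z = ne (NP.suc-injective (res-injective (suc t) (suc t') (s≤s z≤n) lt (s≤s z≤n) lt' (sym (resN-−≡0 n (P t') (P t) z))))

      invWindow-+-res≢0 : ∀ t t' → t ℕ.< n → t' ℕ.< n → resN n (P t' + P t) ≢ 0
      invWindow-+-res≢0 t t' lt lt' z = res≢res-neg (suc t') (suc t) (s≤s z≤n) lt' (s≤s z≤n) lt (resN-+≡0 n (P t') (P t) z)

      invWindow-+[n+1]-res≢0 : ∀ t → t ℕ.< n → resN n (P t + + suc n) ≢ 0
      invWindow-+[n+1]-res≢0 t lt z = res≢res-neg (suc t) (suc t) (s≤s z≤n) lt (s≤s z≤n) lt (resN-+[n+1]≡0 n (P t) z)

    open InversionSums (pairInv n) (pointInv n)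

    inversions : List (Fin (suc n)) → ℕ
    inversions u = pairSum (invWindow n 1≤n u) n ℕ.+ pointSum (invWindow n 1≤n u) n

    L : ℕ
    L = ℕ.pred n
    suc-pred-n : suc L ≡ n
    suc-pred-n = NP.suc-pred n ⦃ ℕ.>-nonZero 1≤n ⦄

    inversions-s₀ : ∀ i u → toℕ i ≡ 0 → inversions (i ∷ u) ≡ inversions u
    inversions-s₀ i u e = cong₂ ℕ._+_ (trans (pairSum-cong _ _ n (invWindow-s₀ n 1≤n i u e)) (subst (λ m → pairSum (update 0 a' P) m ≡ pairSum P m) suc-pred-n (pairSum-update-head a' P L (λ b → pairInv-negˡ n (P 0) b))))
       (trans (pointSum-cong _ _ n (invWindow-s₀ n 1≤n i u e)) (subst (λ m → pointSum (update 0 a' P) m ≡ pointSum P m) suc-pred-n hh))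
      where
      P = invWindow n 1≤n u
      a' = - P 0
      hh : pointSum (update 0 a' P) (suc L) ≡ pointSum P (suc L)
      hh = NP.+-cancelʳ-≡ (pointInv n (P 0)) _ _ (trans (pointSum-update-head a' P L) (cong (pointSum P (suc L) ℕ.+_) (pointInv-neg n (P 0) (InvWindow.invWindow-+[n+1]-res≢0 u 0 1≤n))))

    private
      pk : ∀ i u k → toℕ i ≡ suc k → (k+2≤n : suc (suc k) ℕ.≤ n) →
        pairSum (invWindow n 1≤n (i ∷ u)) n ℕ.+ pairInv n (invWindow n 1≤n u k) (invWindow n 1≤n u (suc k)) ≡ pairSum (invWindow n 1≤n u) n ℕ.+ pairInv n (invWindow n 1≤n u (suc k)) (invWindow n 1≤n u k)
      pk i u k e k+2≤n = trans (cong (ℕ._+ _) (pairSum-cong _ _ n (invWindow-sₖ n 1≤n i u k e k+2≤n))) (pairSum-swap k (invWindow n 1≤n u) n k+2≤n)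
      hk : ∀ i u k → toℕ i ≡ suc k → (k+2≤n : suc (suc k) ℕ.≤ n) → pointSum (invWindow n 1≤n (i ∷ u)) n ≡ pointSum (invWindow n 1≤n u) n
      hk i u k e k+2≤n = trans (pointSum-cong _ _ n (invWindow-sₖ n 1≤n i u k e k+2≤n)) (pointSum-swap k (invWindow n 1≤n u) n k+2≤n)

    inversions-sₖ-≤ : ∀ i u k → toℕ i ≡ suc k → (k+2≤n : suc (suc k) ℕ.≤ n) → inversions (i ∷ u) ℕ.≤ suc (inversions u)
    inversions-sₖ-≤ i u k e k+2≤n = NP.+-mono-≤ (+-≡-cancel-≤ _ _ _ _ (pk i u k e k+2≤n) (pairInv-swap-≤ n (invWindow n 1≤n u k) (invWindow n 1≤n u (suc k)))) (NP.≤-reflexive (hk i u k e k+2≤n))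

    inversions-sₖ-descent : ∀ i u k → toℕ i ≡ suc k → (k+2≤n : suc (suc k) ℕ.≤ n) → invWindow n 1≤n u (suc k) < invWindow n 1≤n u k → suc (inversions (i ∷ u)) ≡ inversions u
    inversions-sₖ-descent i u k e k+2≤n lt = cong₂ ℕ._+_ (+-≡-cancel-suc _ _ _ (trans (cong (pairSum (invWindow n 1≤n (i ∷ u)) n ℕ.+_) sd) (pk i u k e k+2≤n))) (hk i u k e k+2≤n)
      where
      sd : suc (pairInv n (invWindow n 1≤n u (suc k)) (invWindow n 1≤n u k)) ≡ pairInv n (invWindow n 1≤n u k) (invWindow n 1≤n u (suc k))
      sd = pairInv-swap-descent n (invWindow n 1≤n u k) (invWindow n 1≤n u (suc k)) (InvWindow.invWindow-−-res≢0 u k (suc k) (NP.≤-trans (NP.n≤1+n _) k+2≤n) k+2≤n (λ q → NP.1+n≢n (sym q))) lt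

    private
      pn : ∀ i u → toℕ i ≡ n → pairSum (invWindow n 1≤n (i ∷ u)) n ≡ pairSum (invWindow n 1≤n u) n
      pn i u e = trans (pairSum-cong _ _ n (invWindow-sₙ n 1≤n i u e)) (subst (λ m → pairSum (update L a' P) m ≡ pairSum P m) suc-pred-n
         (pairSum-update-last L a' P (λ t lt → pairInv-reflectʳ n (P t) (P L) (InvWindow.invWindow-−-res≢0 u t L (lt' t lt) L<n (λ q → NP.<-irrefl q lt)) (InvWindow.invWindow-+-res≢0 u t L (lt' t lt) L<n))))
        where
        P = invWindow n 1≤n u
        a' = Nℤ n - P L
        L<n : L ℕ.< n
        L<n = subst (L ℕ.<_) suc-pred-n NP.≤-refl
        lt' : ∀ t → t ℕ.< L → t ℕ.< n
        lt' t lt = NP.<-trans lt L<n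
      hn : ∀ i u → toℕ i ≡ n → pointSum (invWindow n 1≤n (i ∷ u)) n ℕ.+ pointInv n (invWindow n 1≤n u L) ≡ pointSum (invWindow n 1≤n u) n ℕ.+ pointInv n (Nℤ n - invWindow n 1≤n u L)
      hn i u e = trans (cong (ℕ._+ _) (pointSum-cong _ _ n (invWindow-sₙ n 1≤n i u e)))
         (subst (λ m → pointSum (update L (Nℤ n - invWindow n 1≤n u L) (invWindow n 1≤n u)) m ℕ.+ pointInv n (invWindow n 1≤n u L) ≡ pointSum (invWindow n 1≤n u) m ℕ.+ pointInv n (Nℤ n - invWindow n 1≤n u L)) suc-pred-n
           (pointSum-update-last L (Nℤ n - invWindow n 1≤n u L) (invWindow n 1≤n u)))

    inversions-sₙ-≤ : ∀ i u → toℕ i ≡ n → inversions (i ∷ u) ℕ.≤ suc (inversions u)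
    inversions-sₙ-≤ i u e = subst (inversions (i ∷ u) ℕ.≤_) (NP.+-suc (pairSum (invWindow n 1≤n u) n) _)
      (NP.+-mono-≤ (NP.≤-reflexive (pn i u e)) (+-≡-cancel-≤ _ _ _ _ (hn i u e) (pointInv-reflect-≤ n (invWindow n 1≤n u L) (InvWindow.invWindow-+[n+1]-res≢0 u L (subst (L ℕ.<_) suc-pred-n NP.≤-refl)))))

    inversions-sₙ-descent : ∀ i u → toℕ i ≡ n → + suc n < invWindow n 1≤n u L → suc (inversions (i ∷ u)) ≡ inversions u
    inversions-sₙ-descent i u e lt = trans (sym (NP.+-suc (pairSum (invWindow n 1≤n (i ∷ u)) n) _)) (cong₂ ℕ._+_ (pn i u e)
        (+-≡-cancel-suc _ _ _ (trans (cong (pointSum (invWindow n 1≤n (i ∷ u)) n ℕ.+_) (pointInv-reflect-descent n (invWindow n 1≤n u L) lt (InvWindow.invWindow-+[n+1]-res≢0 u L (subst (L ℕ.<_) suc-pred-n NP.≤-refl)))) (hn i u e))))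

    inversions-[] : inversions [] ≡ 0
    inversions-[] = cong₂ ℕ._+_ (pairSum-zero (invWindow n 1≤n []) n pz) (pointSum-zero (invWindow n 1≤n []) n hz)
      where
      ∣quoN∣-small : ∀ m → m ℕ.< N n → ∣quoN∣ n (+ m) ≡ 0
      ∣quoN∣-small m m<N = cong ℤ.∣_∣ (quoN-small n m m<N)
      nN : ∀ {a} → a ℕ.≤ n ℕ.+ n → a ℕ.< N n
      nN le = NP.≤-<-trans le (subst (n ℕ.+ n ℕ.<_) (sym (N≡2+[n+n] n)) (NP.n≤1+n _))
      pz : ∀ t t' → t ℕ.< t' → t' ℕ.< n → pairInv n (+ suc t) (+ suc t') ≡ 0
      pz t t' lt lt' = cong₂ ℕ._+_ (trans (cong (∣quoN∣ n) (trans (ZP.m-n≡m⊖n (suc t') (suc t)) (ZP.⊖-≥ (NP.<⇒≤ (s≤s lt)))))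
           (∣quoN∣-small (t' ℕ.∸ t) (nN (NP.≤-trans (NP.m∸n≤m t' t) (NP.≤-trans (NP.<⇒≤ lt') (NP.m≤m+n n n))))))
        (trans (cong (∣quoN∣ n) (sym (ZP.pos-+ (suc t) (suc t')))) (∣quoN∣-small _ (nN (NP.+-mono-≤ (NP.<-trans lt lt') lt'))))
      hz : ∀ t → t ℕ.< n → pointInv n (+ suc t) ≡ 0
      hz t lt = trans (cong (∣quoN∣ n) (sym (ZP.pos-+ (suc t) (suc n)))) (∣quoN∣-small _ (subst (λ z → suc t ℕ.+ suc n ℕ.< z) (sym (N≡2+[n+n] n)) (NP.≤-trans (s≤s (NP.+-monoˡ-< (suc n) lt)) (NP.≤-reflexive (cong suc (NP.+-suc n n))))))

  module _ (n : ℕ) where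
    quoN-+-same : ∀ x d r' → r' ℕ.< N n → + resN n x + d ≡ + r' → quoN n (x + d) ≡ quoN n x
    quoN-+-same x d r' lt e = proj₂ (divMod-unique (N n) (x + d) r' (quoN n x) lt (trans (cong (_+ d) (resN+quoN*N n x)) (trans (l (+ resN n x) (quoN n x * Nℤ n) d) (cong (_+ quoN n x * Nℤ n) e))))
      where
      l : ∀ (r m d : ℤ) → r + m + d ≡ r + d + m
      l = solve-∀

    quoN-+-shift : ∀ x d r' k → r' ℕ.< N n → + resN n x + d ≡ + r' + k * Nℤ n → quoN n (x + d) ≡ quoN n x + k
    quoN-+-shift x d r' k lt e = proj₂ (divMod-unique (N n) (x + d) r' (quoN n x + k) lt (trans (cong (_+ d) (resN+quoN*N n x)) (trans (l (+ resN n x) (quoN n x * Nℤ n) d) (trans (cong (_+ quoN n x * Nℤ n) e) (l2 (+ r') k (quoN n x) (Nℤ n))))))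
      where
      l : ∀ (r m d : ℤ) → r + m + d ≡ r + d + m
      l = solve-∀
      l2 : ∀ (r k q m : ℤ) → r + k * m + q * m ≡ r + (q + k) * m
      l2 = solve-∀

  module _ (n : ℕ) (1≤n : 1 ℕ.≤ n) where
    resN−1 : ℕ
    resN−1 = resN n -[1+ 0 ]
    resN−1+1≡N : resN−1 ℕ.+ 1 ≡ N n
    resN−1+1≡N = resN-neg+m≡N n 1 (s≤s z≤n) (NP.≤-<-trans 1≤n (n<N n))
    resN−1+1≡Nℤ : + resN−1 + + 1 ≡ Nℤ n
    resN−1+1≡Nℤ = trans (sym (ZP.pos-+ resN−1 1)) (cong +_ resN−1+1≡N)

    quoN-s₀-1 : ∀ i → toℕ i ≡ 0 → ∀ x → resN n x ≡ 1 → quoN n (gen n i x) ≡ quoN n x - + 1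
    quoN-s₀-1 i e x r = trans (cong (quoN n) (trans (gen-s₀ n i e x) (swapP-b n -[1+ 0 ] (+ 1) x (λ q → resN-−1≢1 n 1≤n (trans (sym q) (trans r (sym (resN-1 n 1≤n))))) (trans r (sym (resN-1 n 1≤n))))))
       (quoN-+-shift n x (- (+ 1 - -[1+ 0 ])) resN−1 (- + 1) (subst (resN−1 ℕ.<_) resN−1+1≡N (NP.m<m+n resN−1 (s≤s z≤n)))
          (trans (cong (λ z → + z + (- (+ 1 - -[1+ 0 ]))) r) (trans (l (+ resN−1)) (cong (λ z → + resN−1 + - + 1 * z) resN−1+1≡Nℤ))))
      where
      l : ∀ (r : ℤ) → + 1 + (- (+ 1 - - + 1)) ≡ r + - + 1 * (r + + 1)
      l = solve-∀

    quoN-s₀-−1 : ∀ i → toℕ i ≡ 0 → ∀ x → resN n x ≡ resN−1 → quoN n (gen n i x) ≡ quoN n x + + 1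
    quoN-s₀-−1 i e x r = trans (cong (quoN n) (trans (gen-s₀ n i e x) (swapP-a n -[1+ 0 ] (+ 1) x r)))
       (quoN-+-shift n x (+ 1 - -[1+ 0 ]) 1 (+ 1) (NP.≤-<-trans 1≤n (n<N n))
          (trans (cong (λ z → + z + (+ 1 - -[1+ 0 ])) r) (trans (l (+ resN−1)) (cong (λ z → + 1 + + 1 * z) resN−1+1≡Nℤ))))
      where
      l : ∀ (r : ℤ) → r + (+ 1 - - + 1) ≡ + 1 + + 1 * (r + + 1)
      l = solve-∀

    quoN-s₀-other : ∀ i → toℕ i ≡ 0 → ∀ x → resN n x ≢ 1 → resN n x ≢ resN−1 → quoN n (gen n i x) ≡ quoN n x
    quoN-s₀-other i e x a b = cong (quoN n) (trans (gen-s₀ n i e x) (swapP-other n -[1+ 0 ] (+ 1) x b (λ q → a (trans q (resN-1 n 1≤n)))))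

    quoN-sₙ : ∀ i → toℕ i ≡ n → ∀ x → quoN n (gen n i x) ≡ quoN n x
    quoN-sₙ i e x = trans (cong (quoN n) (gen-sₙ n i e 1≤n x)) (by-cases (swapCase n x (+ n) (+ (n ℕ.+ 2))))
      where
      l1 : ∀ (a b : ℤ) → a + (b - a) ≡ b
      l1 = solve-∀
      l2 : ∀ (a b : ℤ) → b - (b - a) ≡ a
      l2 = solve-∀
      by-cases : SwapCase n x (+ n) (+ (n ℕ.+ 2)) → quoN n (swapP n (+ n) (+ (n ℕ.+ 2)) x) ≡ quoN n x
      by-cases (at-a r) = trans (cong (quoN n) (swapP-a n (+ n) (+ (n ℕ.+ 2)) x r)) (quoN-+-same n x (+ (n ℕ.+ 2) - + n) (n ℕ.+ 2) (subst (n ℕ.+ 2 ℕ.<_) (sym (N≡n+2+n n)) (NP.m<m+n (n ℕ.+ 2) 1≤n))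
          (trans (cong (λ z → + z + (+ (n ℕ.+ 2) - + n)) (trans r (resN-n n 1≤n))) (l1 (+ n) (+ (n ℕ.+ 2)))))
      by-cases (at-b ne r) = trans (cong (quoN n) (swapP-b n (+ n) (+ (n ℕ.+ 2)) x ne r)) (quoN-+-same n x (- (+ (n ℕ.+ 2) - + n)) n (n<N n)
          (trans (cong (λ z → + z - (+ (n ℕ.+ 2) - + n)) (trans r (resN-n+2 n 1≤n))) (l2 (+ n) (+ (n ℕ.+ 2)))))
      by-cases (elsewhere a b) = cong (quoN n) (swapP-other n (+ n) (+ (n ℕ.+ 2)) x a b)

    quoN-sₖ : ∀ i k → toℕ i ≡ suc k → (k+2≤n : suc (suc k) ℕ.≤ n) → ∀ x → quoN n (gen n i x) ≡ quoN n x
    quoN-sₖ i k e k+2≤n x = trans (cong (quoN n) (gen-sₖ n i k e (suc≢n n 1≤n k k+2≤n) x)) (through-neg (swapCase n x A' B'))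
      where
      A = + suc k
      B = + suc (suc k)
      A' = - A
      B' = - B
      R1 = resN n A'
      R2 = resN n B'
      k+1≤n = Sₖ.k+1≤n n 1≤n k k+2≤n
      e1 : R1 ℕ.+ suc k ≡ N n
      e1 = resN-neg+m≡N n (suc k) (s≤s z≤n) (NP.≤-<-trans k+1≤n (n<N n))
      e2 : R2 ℕ.+ suc (suc k) ≡ N n
      e2 = resN-neg+m≡N n (suc (suc k)) (s≤s z≤n) (NP.≤-<-trans k+2≤n (n<N n))
      R12 : R1 ≡ suc R2
      R12 = NP.+-cancelʳ-≡ (suc k) R1 (suc R2) (trans e1 (trans (sym e2) (NP.+-suc R2 (suc k))))
      R1<N : R1 ℕ.< N n
      R1<N = resN<N n A'
      R2<N : R2 ℕ.< N n
      R2<N = resN<N n B'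
      BA : B ≡ + 1 + A
      BA = ZP.pos-+ 1 (suc k)
      O = Sₖ.O n 1≤n k k+2≤n
      fixA : ∀ y → resN n y ≡ R1 → O y ≡ y
      fixA y r = swapP-other n A B y (λ q → Sₖ.pn n 1≤n k k+2≤n (suc k) k k+1≤n k+1≤n (trans (sym r) q)) (λ q → Sₖ.pn n 1≤n k k+2≤n (suc (suc k)) k k+2≤n k+1≤n (trans (sym r) q))
      fixB : ∀ y → resN n y ≡ R2 → O y ≡ y
      fixB y r = swapP-other n A B y (λ q → Sₖ.pn n 1≤n k k+2≤n (suc k) (suc k) k+1≤n k+2≤n (trans (sym r) q)) (λ q → Sₖ.pn n 1≤n k k+2≤n (suc (suc k)) (suc k) k+2≤n k+2≤n (trans (sym r) q))
      sR2 : + R1 ≡ + 1 + + R2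
      sR2 = trans (cong +_ R12) (ZP.pos-+ 1 R2)
      through-pos : ∀ y → SwapCase n y A B → quoN n (O y) ≡ quoN n y
      through-pos y (at-a r) = trans (cong (quoN n) (swapP-a n A B y r)) (quoN-+-same n y (B - A) (suc (suc k)) (NP.≤-<-trans k+2≤n (n<N n))
          (trans (cong (λ z → + z + (B - A)) (trans r (resN-≤n n (suc k) k+1≤n))) (l1 A B)))
        where
        l1 : ∀ (a b : ℤ) → a + (b - a) ≡ b
        l1 = solve-∀
      through-pos y (at-b ne r) = trans (cong (quoN n) (swapP-b n A B y ne r)) (quoN-+-same n y (- (B - A)) (suc k) (NP.≤-<-trans k+1≤n (n<N n))
          (trans (cong (λ z → + z - (B - A)) (trans r (resN-≤n n (suc (suc k)) k+2≤n))) (l2 A B)))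
        where
        l2 : ∀ (a b : ℤ) → b - (b - a) ≡ a
        l2 = solve-∀
      through-pos y (elsewhere a b) = cong (quoN n) (swapP-other n A B y a b)
      through-neg : SwapCase n x A' B' → quoN n (O (swapP n A' B' x)) ≡ quoN n x
      through-neg (at-a r) = trans (cong (λ z → quoN n (O z)) (swapP-a n A' B' x r))
         (trans (cong (quoN n) (fixB (x + (B' - A')) (resN-translate n x A' B' r)))
           (quoN-+-same n x (B' - A') R2 R2<N (trans (cong (λ z → + z + (B' - A')) r) (trans (cong (_+ (B' - A')) sR2) (trans (cong (λ z → + 1 + + R2 + (- z - - A)) BA) (l (+ R2) A))))))
        where
        l : ∀ (r a : ℤ) → + 1 + r + (- (+ 1 + a) - - a) ≡ r
        l = solve-∀
      through-neg (at-b ne r) = trans (cong (λ z → quoN n (O z)) (trans (swapP-b n A' B' x ne r) (l1 x A' B')))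
         (trans (cong (quoN n) (fixA (x + (A' - B')) (resN-translate n x B' A' r)))
           (trans (cong (quoN n) (sym (l1 x A' B'))) (quoN-+-same n x (- (B' - A')) R1 R1<N (trans (cong (λ z → + z - (B' - A')) r) (trans (cong (λ z → + R2 - (- z - - A)) BA) (trans (l (+ R2) A) (sym sR2)))))))
        where
        l1 : ∀ (x a b : ℤ) → x - (b - a) ≡ x + (a - b)
        l1 = solve-∀
        l : ∀ (r a : ℤ) → r - (- (+ 1 + a) - - a) ≡ + 1 + r
        l = solve-∀
      through-neg (elsewhere a b) = trans (cong (λ z → quoN n (O z)) (swapP-other n A' B' x a b)) (through-pos x (swapCase n x A B))

  -- The quotient sum, and the lower bound for the number of letters s₀

  module _ (n : ℕ) where
    cW-≤n : ∀ w i → resN n (w (+ i)) ℕ.≤ n → cW n w i ≡ quoN n (w (+ i))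
    cW-≤n w i le with resN n (w (+ i)) ℕ.≤? n
    ... | yes _ = refl
    ... | no ne = ⊥-elim (ne le)

    cW->n : ∀ w i → ¬ (resN n (w (+ i)) ℕ.≤ n) → cW n w i ≡ quoN n (w (+ i)) + + 1
    cW->n w i ne with resN n (w (+ i)) ℕ.≤? n
    ... | yes le = ⊥-elim (ne le)
    ... | no _ = refl

    σW-≤n : ∀ w i → resN n (w (+ i)) ℕ.≤ n → σW n w i ≡ + resN n (w (+ i))
    σW-≤n w i le = begin
      w (+ i) - cW n w i * + N n                                      ≡⟨ cong (λ c → w (+ i) - c * + N n) (cW-≤n w i le) ⟩
      w (+ i) - quoN n (w (+ i)) * + N n                              ≡⟨ cong (_- quoN n (w (+ i)) * + N n) (resN+quoN*N n (w (+ i))) ⟩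
      + resN n (w (+ i)) + quoN n (w (+ i)) * + N n - quoN n (w (+ i)) * + N n ≡⟨ cancel (+ resN n (w (+ i))) (quoN n (w (+ i))) (+ N n) ⟩
      + resN n (w (+ i))                                              ∎
      where
      open ≡-Reasoning
      cancel : ∀ (r q m : ℤ) → r + q * m - q * m ≡ r
      cancel = solve-∀

    σW->n : ∀ w i → ¬ (resN n (w (+ i)) ℕ.≤ n) → σW n w i ≡ + resN n (w (+ i)) - + N n
    σW->n w i ne = begin
      w (+ i) - cW n w i * + N n                                      ≡⟨ cong (λ c → w (+ i) - c * + N n) (cW->n w i ne) ⟩
      w (+ i) - (quoN n (w (+ i)) + + 1) * + N n                      ≡⟨ cong (_- (quoN n (w (+ i)) + + 1) * + N n) (resN+quoN*N n (w (+ i))) ⟩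
      + resN n (w (+ i)) + quoN n (w (+ i)) * + N n - (quoN n (w (+ i)) + + 1) * + N n ≡⟨ cancel (+ resN n (w (+ i))) (quoN n (w (+ i))) (+ N n) ⟩
      + resN n (w (+ i)) - + N n                                      ∎
      where
      open ≡-Reasoning
      cancel : ∀ (r q m : ℤ) → r + q * m - (q + + 1) * m ≡ r - m
      cancel = solve-∀

    σW-neg : ∀ w i → ¬ (resN n (w (+ i)) ℕ.≤ n) → σW n w i < + 0
    σW-neg w i ne = subst (_< + 0) (sym (σW->n w i ne))
      (subst (+ resN n (w (+ i)) - + N n <_) (ZP.+-inverseʳ (+ N n)) (ZP.+-monoˡ-< (- + N n) (+<+ (resN<N n (w (+ i))))))

    cW-negIndicator≡quoN : ∀ w i → cW n w i - + (if ⌊ σW n w i ℤ.<? + 0 ⌋ then 1 else 0) ≡ quoN n (w (+ i))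
    cW-negIndicator≡quoN w i = by-cases (resN n (w (+ i)) ℕ.≤? n)
      where
      cancel : ∀ (q : ℤ) → q + + 1 - + 1 ≡ q
      cancel = solve-∀
      by-cases : Dec (resN n (w (+ i)) ℕ.≤ n) → cW n w i - + (if ⌊ σW n w i ℤ.<? + 0 ⌋ then 1 else 0) ≡ quoN n (w (+ i))
      by-cases (yes le) = trans (cong₂ (λ c b → c - + b) (cW-≤n w i le) (negIndicator-0 (σW n w i) nonneg)) (ZP.+-identityʳ _)
        where
        nonneg : ¬ (σW n w i < + 0)
        nonneg σ<0 with subst (_< + 0) (σW-≤n w i le) σ<0
        ... | +<+ ()
      by-cases (no ne) = trans (cong₂ (λ c b → c - + b) (cW->n w i ne) (negIndicator-1 (σW n w i) (σW-neg w i ne))) (cancel (quoN n (w (+ i))))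

    σW-sign : ∀ w i → resN n (w (+ i)) ≢ 0 → (+ 0 < σW n w i) ⊎ (σW n w i < + 0)
    σW-sign w i r≢0 = by-cases (resN n (w (+ i)) ℕ.≤? n)
      where
      by-cases : Dec (resN n (w (+ i)) ℕ.≤ n) → (+ 0 < σW n w i) ⊎ (σW n w i < + 0)
      by-cases (yes le) = inj₁ (subst (+ 0 <_) (sym (σW-≤n w i le)) (+<+ (NP.n≢0⇒n>0 r≢0)))
      by-cases (no ne) = inj₂ (σW-neg w i ne)

    quotientSum : (ℤ → ℤ) → ℤ
    quotientSum w = sumTo n (λ i → quoN n (w (+ i)))

    sumC-neg≡quotientSum : ∀ w → sumTo n (cW n w) - + negW n w ≡ quotientSum w
    sumC-neg≡quotientSum w = trans (sumTo-−countTo n (cW n w) (λ i → ⌊ σW n w i ℤ.<? + 0 ⌋)) (sumTo-cong n _ _ (λ i _ → cW-negIndicator≡quoN w i))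

  module _ {n : ℕ} where
    countOthers : List (Fin (suc n)) → ℕ
    countOthers [] = 0
    countOthers (i ∷ u) with toℕ i
    ... | zero = countOthers u
    ... | suc _ = suc (countOthers u)

    count0-s₀ : ∀ (i : Fin (suc n)) u → toℕ i ≡ 0 → count0 (i ∷ u) ≡ suc (count0 u)
    count0-s₀ i u e with toℕ i
    ... | zero = refl
    ... | suc _ = case e of λ ()

    count0-other : ∀ (i : Fin (suc n)) u k → toℕ i ≡ suc k → count0 (i ∷ u) ≡ count0 u
    count0-other i u k e with toℕ i
    ... | zero = case e of λ ()
    ... | suc _ = refl

    countOthers-s₀ : ∀ (i : Fin (suc n)) u → toℕ i ≡ 0 → countOthers (i ∷ u) ≡ countOthers u
    countOthers-s₀ i u e with toℕ i
    ... | zero = refl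
    ... | suc _ = case e of λ ()

    countOthers-other : ∀ (i : Fin (suc n)) u k → toℕ i ≡ suc k → countOthers (i ∷ u) ≡ suc (countOthers u)
    countOthers-other i u k e with toℕ i
    ... | zero = case e of λ ()
    ... | suc _ = refl

    length≡count0+countOthers : ∀ u → length u ≡ count0 u ℕ.+ countOthers u
    length≡count0+countOthers [] = refl
    length≡count0+countOthers (i ∷ u) with toℕ i
    ... | zero = cong suc (length≡count0+countOthers u)
    ... | suc _ = trans (cong suc (length≡count0+countOthers u)) (sym (NP.+-suc (count0 u) (countOthers u)))

  module _ (n : ℕ) (1≤n : 1 ℕ.≤ n) where
    module Window (u : List (Fin (suc n))) = OddPeriodic n 1≤n (eval n u) (eval n (reverse u)) (eval-periodic n 1≤n u) (eval-odd n 1≤n u) (eval-reverse-inverseˡ n 1≤n u)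

    inversions≤countOthers : ∀ u → inversions n 1≤n u ℕ.≤ countOthers u
    inversions≤countOthers [] = NP.≤-reflexive (inversions-[] n 1≤n)
    inversions≤countOthers (i ∷ u) with genView n 1≤n i
    ... | is-s₀ e = subst (inversions n 1≤n (i ∷ u) ℕ.≤_) (sym (countOthers-s₀ i u e)) (subst (ℕ._≤ countOthers u) (sym (inversions-s₀ n 1≤n i u e)) (inversions≤countOthers u))
    ... | is-sₙ e = subst (inversions n 1≤n (i ∷ u) ℕ.≤_) (sym (countOthers-other i u (ℕ.pred n) (trans e (sym (NP.suc-pred n ⦃ ℕ.>-nonZero 1≤n ⦄)))))
                   (NP.≤-trans (inversions-sₙ-≤ n 1≤n i u e) (s≤s (inversions≤countOthers u)))
    ... | is-sₖ k e k+2≤n = subst (inversions n 1≤n (i ∷ u) ℕ.≤_) (sym (countOthers-other i u k e)) (NP.≤-trans (inversions-sₖ-≤ n 1≤n i u k e k+2≤n) (s≤s (inversions≤countOthers u)))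

    quotientSum-other : ∀ i u → toℕ i ≢ 0 → quotientSum n (eval n (i ∷ u)) ≡ quotientSum n (eval n u)
    quotientSum-other i u ne with genView n 1≤n i
    ... | is-s₀ e = ⊥-elim (ne e)
    ... | is-sₙ e = sumTo-cong n _ _ (λ j _ → quoN-sₙ n 1≤n i e (eval n u (+ j)))
    ... | is-sₖ k e k+2≤n = sumTo-cong n _ _ (λ j _ → quoN-sₖ n 1≤n i k e k+2≤n (eval n u (+ j)))

    quotientSum-s₀-≤ : ∀ i u → toℕ i ≡ 0 → quotientSum n (eval n (i ∷ u)) ≤ quotientSum n (eval n u) + + 1
    quotientSum-s₀-≤ i u e = subst (_≤ quotientSum n w + + 1) (sym split) (ZP.+-monoʳ-≤ (quotientSum n w) quotient-steps≤1)
      where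
      w = eval n u
      d : ℕ → ℤ
      d j = quoN n (gen n i (w (+ j))) - quoN n (w (+ j))
      l : ∀ (a b : ℤ) → a ≡ b + (a - b)
      l = solve-∀
      split : quotientSum n (eval n (i ∷ u)) ≡ quotientSum n w + sumTo n d
      split = trans (sumTo-cong n _ _ (λ j _ → l (quoN n (gen n i (w (+ j)))) (quoN n (w (+ j))))) (sumTo-+ n _ _)
      Q : ℕ → Set
      Q j = resN n (w (+ j)) ≡ resN−1 n 1≤n
      l1 : ∀ (q : ℤ) → q - + 1 - q ≡ - + 1
      l1 = solve-∀
      l2 : ∀ (q : ℤ) → q + + 1 - q ≡ + 1
      l2 = solve-∀
      quotient-step : ∀ j → (Q j × d j ≡ + 1) ⊎ (¬ Q j × d j ≤ + 0)
      quotient-step j with resN n (w (+ j)) ℕ.≟ resN−1 n 1≤n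
      ... | yes r = inj₁ (r , trans (cong (_- quoN n (w (+ j))) (quoN-s₀-−1 n 1≤n i e (w (+ j)) r)) (l2 (quoN n (w (+ j)))))
      ... | no nr with resN n (w (+ j)) ℕ.≟ 1
      ...   | yes resN-1 = inj₂ (nr , ZP.≤-trans (ZP.≤-reflexive (trans (cong (_- quoN n (w (+ j))) (quoN-s₀-1 n 1≤n i e (w (+ j)) resN-1)) (l1 (quoN n (w (+ j)))))) ℤ.-≤+)
      ...   | no n1 = inj₂ (nr , ZP.≤-reflexive (trans (cong (_- quoN n (w (+ j))) (quoN-s₀-other n 1≤n i e (w (+ j)) n1 nr)) (ZP.+-inverseʳ (quoN n (w (+ j))))))
      quotient-steps≤1 : sumTo n d ≤ + 1
      quotient-steps≤1 = sumTo-≤1 n d Q (λ j _ → c1 j) (λ j _ nq → c2 j nq) (λ a b pa pb qa qb → Window.res-injective u a b (proj₁ pa) (proj₂ pa) (proj₁ pb) (proj₂ pb) (trans qa (sym qb))) (λ j → resN n (w (+ j)) ℕ.≟ resN−1 n 1≤n)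
        where
        c1 : ∀ j → d j ≤ + 1
        c1 j with quotient-step j
        ... | inj₁ (_ , eq) = ZP.≤-reflexive eq
        ... | inj₂ (_ , le) = ZP.≤-trans le (ℤ.+≤+ z≤n)
        c2 : ∀ j → ¬ Q j → d j ≤ + 0
        c2 j nq with quotient-step j
        ... | inj₁ (q , _) = ⊥-elim (nq q)
        ... | inj₂ (_ , le) = le


    quotientSum-[] : quotientSum n (eval n []) ≡ + 0
    quotientSum-[] = sumTo-zero n _ (λ j p → quoN-small n j (NP.≤-<-trans (proj₂ p) (n<N n)))


    quotientSum≤count0 : ∀ u → quotientSum n (eval n u) ≤ + count0 u
    quotientSum≤count0 [] = ZP.≤-reflexive quotientSum-[]
    quotientSum≤count0 (i ∷ u) with genView n 1≤n i
    ... | is-s₀ e = subst (quotientSum n (eval n (i ∷ u)) ≤_) (trans (+-suc-ℤ (count0 u)) (sym (cong +_ (count0-s₀ i u e)))) (ZP.≤-trans (quotientSum-s₀-≤ i u e) (ZP.+-monoˡ-≤ (+ 1) (quotientSum≤count0 u)))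
    ... | is-sₙ e = subst₂ _≤_ (sym (quotientSum-other i u (λ q → NP.<-irrefl (trans (sym q) e) 1≤n))) (sym (cong +_ (count0-other i u (ℕ.pred n) (trans e (sym (NP.suc-pred n ⦃ ℕ.>-nonZero 1≤n ⦄)))))) (quotientSum≤count0 u)
    ... | is-sₖ k e k+2≤n = subst₂ _≤_ (sym (quotientSum-other i u (λ q → case trans (sym q) e of λ ()))) (sym (cong +_ (count0-other i u k e))) (quotientSum≤count0 u)

  -- Descents: a short word for a minimal coset representative

  module _ (n : ℕ) (1≤n : 1 ℕ.≤ n) where
    module FixesWindow (f : ℤ → ℤ) (fE : ∀ x k → f (x + k * Nℤ n) ≡ f x + k * Nℤ n) (fN : ∀ x → f (- x) ≡ - f x)
              (fid : ∀ t → t ℕ.< n → f (+ suc t) ≡ + suc t) where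
      f0 : f (+ 0) ≡ + 0
      f0 = x≡-x⇒x≡0 (f (+ 0)) (fN (+ 0))

      fsn : f (+ suc n) ≡ + suc n
      fsn = ZP.*-cancelˡ-≡ (+ 2) (f s) s (begin
        + 2 * f s                    ≡⟨ double (f s) ⟩
        f s + f s                    ≡⟨ cong (_+_ (f s)) reflected ⟩
        f s + (- f s + + 1 * Nℤ n)   ≡⟨ cancel (f s) (Nℤ n) ⟩
        Nℤ n                         ≡⟨ Nℤ≡[n+1]+[n+1] n ⟩
        s + s                        ≡⟨ double s ⟨
        + 2 * s                      ∎)
        where
        open ≡-Reasoning
        s : ℤ
        s = + suc n
        double : ∀ x → + 2 * x ≡ x + x
        double = solve-∀
        cancel : ∀ x m → x + (- x + + 1 * m) ≡ m
        cancel = solve-∀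
        reflect : ∀ x → x ≡ - x + + 1 * (x + x)
        reflect = solve-∀
        reflected : f s ≡ - f s + + 1 * Nℤ n
        reflected = begin
          f s                          ≡⟨ cong f (trans (reflect s) (cong (λ M → - s + + 1 * M) (sym (Nℤ≡[n+1]+[n+1] n)))) ⟩
          f (- s + + 1 * Nℤ n)         ≡⟨ fE (- s) (+ 1) ⟩
          f (- s) + + 1 * Nℤ n         ≡⟨ cong (_+ + 1 * Nℤ n) (fN s) ⟩
          - f s + + 1 * Nℤ n           ∎

      fres : ∀ r → r ℕ.< N n → f (+ r) ≡ + r
      fres zero lt = f0
      fres (suc t) lt with suc t ℕ.≤? n
      ... | yes le = fid t le
      ... | no nle with suc t ℕ.≟ suc n
      ...   | yes e = trans (cong (λ z → f (+ z)) e) (trans fsn (cong +_ (sym e)))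
      ...   | no ne = trans (cong f er) (trans (fE (- + m) (+ 1)) (trans (cong (λ z → z + + 1 * Nℤ n) (trans (fN (+ m)) (cong -_ fm))) (sym er)))
        where
        r = suc t
        m = N n ℕ.∸ r
        mr : m ℕ.+ r ≡ N n
        mr = NP.m∸n+n≡m (NP.<⇒≤ lt)
        l : ∀ (m r : ℤ) → r ≡ - m + + 1 * (m + r)
        l = solve-∀
        er : + r ≡ - + m + + 1 * Nℤ n
        er = trans (l (+ m) (+ r)) (cong (λ z → - + m + + 1 * z) (trans (sym (ZP.pos-+ m r)) (cong +_ mr)))
        m≥1 : 1 ℕ.≤ m
        m≥1 = NP.m<n⇒0<n∸m lt
        spm : suc (ℕ.pred m) ≡ m
        spm = NP.suc-pred m ⦃ ℕ.>-nonZero m≥1 ⦄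
        n1<r : suc n ℕ.< r
        n1<r = NP.≤∧≢⇒< (NP.≰⇒> nle) (λ q → ne (sym q))
        m≤n : m ℕ.≤ n
        m≤n = NP.+-cancelʳ-≤ r m n (NP.≤-trans (NP.≤-reflexive mr) (subst (ℕ._≤ n ℕ.+ r) (sym (N≡n+[2+n] n)) (NP.+-monoʳ-≤ n n1<r)))
        mlt' : ℕ.pred m ℕ.< n
        mlt' = subst (ℕ._≤ n) (sym spm) m≤n
        fm : f (+ m) ≡ + m
        fm = subst (λ z → f (+ z) ≡ + z) spm (fid (ℕ.pred m) mlt')

      fixes-everything : ∀ z → f z ≡ z
      fixes-everything z = trans (cong f (resN+quoN*N n z)) (trans (fE (+ resN n z) (quoN n z)) (trans (cong (_+ quoN n z * Nℤ n) (fres (resN n z) (resN<N n z))) (sym (resN+quoN*N n z))))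

    identity-word : ∀ u → (∀ t → t ℕ.< n → invWindow n 1≤n u t ≡ + suc t) → SameElt n [] u
    identity-word u pointInv z = sym (trans (cong (eval n u) (sym (FixesWindow.fixes-everything (eval n (reverse u)) (eval-periodic n 1≤n (reverse u)) (eval-odd n 1≤n (reverse u)) pointInv z))) (eval-reverse-inverseʳ n 1≤n u z))

  module SortedWindow (n : ℕ) (1≤n : 1 ℕ.≤ n) (P : ℕ → ℤ)
    (P₀≮0 : ¬ (P 0 < + 0)) (no-descent : ∀ k → suc (suc k) ℕ.≤ n → ¬ (P (suc k) < P k)) (last≯n+1 : ¬ (+ suc n < P (ℕ.pred n)))
    (P₀≢0 : P 0 ≢ + 0) (last≢n+1 : P (ℕ.pred n) ≢ + suc n) (adjacent≢ : ∀ t → suc t ℕ.< n → P t ≢ P (suc t)) where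

    increasing : ∀ t → suc t ℕ.< n → P t < P (suc t)
    increasing t lt = ZP.≤∧≢⇒< (ZP.≮⇒≥ (no-descent t lt)) (adjacent≢ t lt)

    lower : ∀ t → t ℕ.< n → + suc t ≤ P t
    lower zero lt = ZP.i<j⇒suc[i]≤j (ZP.≤∧≢⇒< (ZP.≮⇒≥ P₀≮0) (λ q → P₀≢0 (sym q)))
    lower (suc t) lt = ZP.≤-trans (ZP.+-monoʳ-≤ (+ 1) (lower t (NP.<-trans (NP.n<1+n t) lt))) (ZP.i<j⇒suc[i]≤j (increasing t lt))

    upper : ∀ d t → t ℕ.+ d ≡ ℕ.pred n → P t ≤ + suc t
    upper zero t e = <-suc⇒≤ (P t) (suc t) (subst (λ z → P z < + suc (suc z)) (trans (sym e) e') lastlt)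
      where
      e' : t ℕ.+ 0 ≡ t
      e' = NP.+-identityʳ t
      sn : suc (ℕ.pred n) ≡ n
      sn = NP.suc-pred n ⦃ ℕ.>-nonZero 1≤n ⦄
      lastlt : P (ℕ.pred n) < + suc (suc (ℕ.pred n))
      lastlt = subst (λ z → P (ℕ.pred n) < + suc z) (sym sn) (ZP.≤∧≢⇒< (ZP.≮⇒≥ last≯n+1) last≢n+1)
    upper (suc d) t e = <-suc⇒≤ (P t) (suc t) (ZP.<-≤-trans (increasing t lt) (upper d (suc t) (trans (sym (NP.+-suc t d)) e)))
      where
      sn : suc (ℕ.pred n) ≡ n
      sn = NP.suc-pred n ⦃ ℕ.>-nonZero 1≤n ⦄
      lt : suc t ℕ.< n
      lt = subst (suc (suc t) ℕ.≤_) sn (s≤s (subst (suc t ℕ.≤_) e (NP.≤-trans (s≤s (NP.m≤m+n t d)) (NP.≤-reflexive (sym (NP.+-suc t d))))))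

    window-identity : ∀ t → t ℕ.< n → P t ≡ + suc t
    window-identity t lt = ZP.≤-antisym (upper (ℕ.pred n ℕ.∸ t) t (NP.m+[n∸m]≡n (NP.≤-pred (subst (t ℕ.<_) (sym (NP.suc-pred n ⦃ ℕ.>-nonZero 1≤n ⦄)) lt)))) (lower t lt)

  module _ (n : ℕ) (1≤n : 1 ℕ.≤ n) where
    NonNegQuotients : List (Fin (suc n)) → Set
    NonNegQuotients u = ∀ j → InRange n j → + 0 ≤ quoN n (eval n u (+ j))

    potential : List (Fin (suc n)) → ℤ
    potential u = + inversions n 1≤n u + quotientSum n (eval n u)

    resN-+-shift : ∀ x d r' k → r' ℕ.< N n → + resN n x + d ≡ + r' + k * Nℤ n → resN n (x + d) ≡ r'
    resN-+-shift x d r' k lt e = proj₁ (divMod-unique (N n) (x + d) r' (quoN n x + k) lt (trans (cong (_+ d) (resN+quoN*N n x)) (trans (l (+ resN n x) (quoN n x * Nℤ n) d) (trans (cong (_+ quoN n x * Nℤ n) e) (l2 (+ r') k (quoN n x) (Nℤ n))))))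
      where
      l : ∀ (r m d : ℤ) → r + m + d ≡ r + d + m
      l = solve-∀
      l2 : ∀ (r k q m : ℤ) → r + k * m + q * m ≡ r + (q + k) * m
      l2 = solve-∀

    invWindow-res≢0 : ∀ u t → t ℕ.< n → resN n (invWindow n 1≤n u t) ≢ 0
    invWindow-res≢0 u t lt z = InvWindow.res≢res-neg n 1≤n u (suc t) (suc t) (s≤s z≤n) lt (s≤s z≤n) lt (trans z (sym z'))
      where
      z' : resN n (- invWindow n 1≤n u t) ≡ 0
      z' = resN-cong-neg n (invWindow n 1≤n u t) (+ 0) (trans z (sym (resN-small n 0 (s≤s z≤n))))

    module DescentS₀ (u : List (Fin (suc n))) (pos : NonNegQuotients u) (lt : invWindow n 1≤n u 0 < + 0) where
      w : ℤ → ℤ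
      w = eval n u
      P0 : ℤ
      P0 = invWindow n 1≤n u 0
      wP : w P0 ≡ + 1
      wP = eval-reverse-inverseʳ n 1≤n u (+ 1)
      r : ℕ
      r = resN n P0
      q : ℤ
      q = quoN n P0
      m : ℕ
      m = proj₁ (quoN-negative n P0 lt)
      qe : q ≡ -[1+ m ]
      qe = proj₂ (quoN-negative n P0 lt)
      r≢0 : r ≢ 0
      r≢0 = invWindow-res≢0 u 0 1≤n
      r≢sn : r ≢ suc n
      r≢sn e = InvWindow.invWindow-+[n+1]-res≢0 n 1≤n u 0 1≤n (resN-+-shift P0 (+ suc n) 0 (+ 1) (s≤s z≤n)
                 (trans (cong (λ z → + z + + suc n) e) (trans (l (+ suc n)) (cong (λ M → + 0 + + 1 * M) (sym (Nℤ≡[n+1]+[n+1] n))))))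
        where
        l : ∀ (s : ℤ) → s + s ≡ + 0 + + 1 * (s + s)
        l = solve-∀

      r<N : r ℕ.< N n
      r<N = resN<N n P0

      r≤n : r ℕ.≤ n
      r≤n with r ℕ.≤? n
      ... | yes le = le
      ... | no nle = ⊥-elim (contra (pos m0 (m≥1 , m≤n)))
        where
        m0 = N n ℕ.∸ r
        mr : m0 ℕ.+ r ≡ N n
        mr = NP.m∸n+n≡m (NP.<⇒≤ r<N)
        m≥1 : 1 ℕ.≤ m0
        m≥1 = NP.m<n⇒0<n∸m r<N
        n1<r : suc n ℕ.< r
        n1<r = NP.≤∧≢⇒< (NP.≰⇒> nle) (λ e → r≢sn (sym e))
        m≤n : m0 ℕ.≤ n
        m≤n = NP.+-cancelʳ-≤ r m0 n (NP.≤-trans (NP.≤-reflexive mr) (subst (ℕ._≤ n ℕ.+ r) (sym (N≡n+[2+n] n)) (NP.+-monoʳ-≤ n n1<r)))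
        l1 : ∀ (a r q : ℤ) → a ≡ - (r + q * (a + r)) + (q + + 1) * (a + r)
        l1 = solve-∀
        em : + m0 + + r ≡ Nℤ n
        em = trans (sym (ZP.pos-+ m0 r)) (cong +_ mr)
        e1 : + m0 ≡ - P0 + (q + + 1) * Nℤ n
        e1 = trans (l1 (+ m0) (+ r) q) (trans (cong (λ M → - (+ r + q * M) + (q + + 1) * M) em) (cong (λ z → - z + (q + + 1) * Nℤ n) (sym (resN+quoN*N n P0))))
        l2 : ∀ (q r : ℤ) → - + 1 + (q + + 1) * (r + + 1) ≡ r + q * (r + + 1)
        l2 = solve-∀
        e2 : w (+ m0) ≡ + resN−1 n 1≤n + q * Nℤ n
        e2 = trans (cong w e1) (trans (eval-periodic n 1≤n u (- P0) (q + + 1)) (trans (cong (λ z → z + (q + + 1) * Nℤ n) (trans (eval-odd n 1≤n u P0) (cong -_ wP)))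
               (trans (cong (λ M → - + 1 + (q + + 1) * M) (sym (resN−1+1≡Nℤ n 1≤n))) (trans (l2 q (+ resN−1 n 1≤n)) (cong (λ M → + resN−1 n 1≤n + q * M) (resN−1+1≡Nℤ n 1≤n))))))
        qm : quoN n (w (+ m0)) ≡ q
        qm = proj₂ (divMod-unique (N n) (w (+ m0)) (resN−1 n 1≤n) q (resN<N n -[1+ 0 ]) e2)
        contra : + 0 ≤ quoN n (w (+ m0)) → ⊥
        contra p with subst (+ 0 ≤_) (trans qm qe) p
        ... | ()

      i0 : ℕ
      i0 = r
      i0R : InRange n i0
      i0R = NP.n≢0⇒n>0 r≢0 , r≤n
      e3 : + r ≡ P0 + (- q) * Nℤ n
      e3 = trans (l (+ r) q (Nℤ n)) (cong (λ z → z + (- q) * Nℤ n) (sym (resN+quoN*N n P0)))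
        where
        l : ∀ (r q M : ℤ) → r ≡ r + q * M + (- q) * M
        l = solve-∀
      wi0 : w (+ i0) ≡ + 1 + (- q) * Nℤ n
      wi0 = trans (cong w e3) (trans (eval-periodic n 1≤n u P0 (- q)) (cong (_+ (- q) * Nℤ n) wP))
      ri0 : resN n (w (+ i0)) ≡ 1
      ri0 = proj₁ (divMod-unique (N n) (w (+ i0)) 1 (- q) (NP.≤-<-trans 1≤n (n<N n)) wi0)
      qi0 : quoN n (w (+ i0)) ≡ + suc m
      qi0 = trans (proj₂ (divMod-unique (N n) (w (+ i0)) 1 (- q) (NP.≤-<-trans 1≤n (n<N n)) wi0)) (cong -_ qe)

      i : Fin (suc n)
      i = Data.Fin.zero
      ie : toℕ i ≡ 0
      ie = refl

      other1 : ∀ j → InRange n j → j ≢ i0 → resN n (w (+ j)) ≢ 1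
      other1 j jr ne e = ne (Window.res-injective n 1≤n u j i0 (proj₁ jr) (proj₂ jr) (proj₁ i0R) (proj₂ i0R) (trans e (sym ri0)))
      otherR : ∀ j → InRange n j → resN n (w (+ j)) ≢ resN−1 n 1≤n
      otherR j jr e = Window.res≢res-neg n 1≤n u j i0 (proj₁ jr) (proj₂ jr) (proj₁ i0R) (proj₂ i0R) (trans e (sym (resN-cong-neg n (w (+ i0)) (+ 1) (trans ri0 (sym (resN-1 n 1≤n))))))

      d : ℕ → ℤ
      d j = quoN n (gen n i (w (+ j))) - quoN n (w (+ j))
      l : ∀ (a b : ℤ) → a ≡ b + (a - b)
      l = solve-∀
      split : quotientSum n (eval n (i ∷ u)) ≡ quotientSum n w + sumTo n d
      split = trans (sumTo-cong n _ _ (λ j _ → l (quoN n (gen n i (w (+ j)))) (quoN n (w (+ j))))) (sumTo-+ n _ _)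
      l1 : ∀ (q : ℤ) → q - + 1 - q ≡ - + 1
      l1 = solve-∀
      di0 : d i0 ≡ - + 1
      di0 = trans (cong (_- quoN n (w (+ i0))) (quoN-s₀-1 n 1≤n i ie (w (+ i0)) ri0)) (l1 (quoN n (w (+ i0))))
      dj : ∀ j → InRange n j → j ≢ i0 → d j ≡ + 0
      dj j jr ne = trans (cong (_- quoN n (w (+ j))) (quoN-s₀-other n 1≤n i ie (w (+ j)) (other1 j jr ne) (otherR j jr))) (ZP.+-inverseʳ (quoN n (w (+ j))))
      quotientSum-drops : quotientSum n (eval n (i ∷ u)) ≡ quotientSum n w - + 1
      quotientSum-drops = trans split (cong (_+_ (quotientSum n w)) (trans (sumTo-single n d i0 i0R dj) di0))

      nonneg′ : NonNegQuotients (i ∷ u)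
      nonneg′ j jr with j ℕ.≟ i0
      ... | yes refl = subst (+ 0 ≤_) (sym (trans (quoN-s₀-1 n 1≤n i ie (w (+ i0)) ri0) (cong (_- + 1) qi0))) (ℤ.+≤+ z≤n)
      ... | no ne = subst (+ 0 ≤_) (sym (quoN-s₀-other n 1≤n i ie (w (+ j)) (other1 j jr ne) (otherR j jr))) (pos j jr)

      potential-drops : potential (i ∷ u) + + 1 ≡ potential u
      potential-drops = trans (cong (λ z → + inversions n 1≤n (i ∷ u) + z + + 1) quotientSum-drops) (trans (cong (λ b → + b + (quotientSum n w - + 1) + + 1) (inversions-s₀ n 1≤n i u ie)) (l2 (+ inversions n 1≤n u) (quotientSum n w)))
        where
        l2 : ∀ (b f : ℤ) → b + (f - + 1) + + 1 ≡ b + f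
        l2 = solve-∀

    potential-descent : ∀ i u → toℕ i ≢ 0 → suc (inversions n 1≤n (i ∷ u)) ≡ inversions n 1≤n u → potential (i ∷ u) + + 1 ≡ potential u
    potential-descent i u ne eb = trans (cong (λ f → + inversions n 1≤n (i ∷ u) + f + + 1) (quotientSum-other n 1≤n i u ne))
      (trans (l (+ inversions n 1≤n (i ∷ u)) (quotientSum n (eval n u))) (cong (_+ quotientSum n (eval n u)) (trans (+-suc-ℤ (inversions n 1≤n (i ∷ u))) (cong +_ eb))))
      where
      l : ∀ (b f : ℤ) → b + f + + 1 ≡ b + + 1 + f
      l = solve-∀

    descent-sₖ : ∀ u → NonNegQuotients u → ∀ k → (k+2≤n : suc (suc k) ℕ.≤ n) → invWindow n 1≤n u (suc k) < invWindow n 1≤n u k →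
            Σ (Fin (suc n)) λ i → NonNegQuotients (i ∷ u) × (potential (i ∷ u) + + 1 ≡ potential u)
    descent-sₖ u pos k k+2≤n lt = i , (λ j jr → subst (+ 0 ≤_) (sym (quoN-sₖ n 1≤n i k ie k+2≤n (eval n u (+ j)))) (pos j jr)) ,
         potential-descent i u (λ q → case trans (sym ie) q of λ ()) (inversions-sₖ-descent n 1≤n i u k ie k+2≤n lt)
      where
      i : Fin (suc n)
      i = Data.Fin.fromℕ< (s≤s (NP.≤-trans (NP.n≤1+n (suc k)) k+2≤n))
      ie : toℕ i ≡ suc k
      ie = Data.Fin.Properties.toℕ-fromℕ< (s≤s (NP.≤-trans (NP.n≤1+n (suc k)) k+2≤n))

    descent-sₙ : ∀ u → NonNegQuotients u → + suc n < invWindow n 1≤n u (ℕ.pred n) →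
            Σ (Fin (suc n)) λ i → NonNegQuotients (i ∷ u) × (potential (i ∷ u) + + 1 ≡ potential u)
    descent-sₙ u pos lt = i , (λ j jr → subst (+ 0 ≤_) (sym (quoN-sₙ n 1≤n i ie (eval n u (+ j)))) (pos j jr)) ,
         potential-descent i u (λ q → NP.<-irrefl (trans (sym q) ie) 1≤n) (inversions-sₙ-descent n 1≤n i u ie lt)
      where
      i : Fin (suc n)
      i = Data.Fin.fromℕ n
      ie : toℕ i ≡ n
      ie = Data.Fin.Properties.toℕ-fromℕ n

    data Descent (u : List (Fin (suc n))) : Set where
      atIdentity : (∀ t → t ℕ.< n → invWindow n 1≤n u t ≡ + suc t) → Descent u
      descend : Σ (Fin (suc n)) (λ i → NonNegQuotients (i ∷ u) × (potential (i ∷ u) + + 1 ≡ potential u)) → Descent u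

    module SearchDescent (P : ℕ → ℤ) where
      searchAdjacentDescent : ∀ m → (Σ ℕ λ k → (suc (suc k) ℕ.≤ n) × (P (suc k) < P k)) ⊎ (∀ k → k ℕ.< m → suc (suc k) ℕ.≤ n → ¬ (P (suc k) < P k))
      searchAdjacentDescent zero = inj₂ (λ k ())
      searchAdjacentDescent (suc m) with searchAdjacentDescent m
      ... | inj₁ x = inj₁ x
      ... | inj₂ f with suc (suc m) ℕ.≤? n | P (suc m) ℤ.<? P m
      ...   | yes le | yes lt = inj₁ (m , le , lt)
      ...   | yes le | no nlt = inj₂ (λ k kl k+2≤n → case NP.m≤n⇒m<n∨m≡n (NP.≤-pred kl) of λ { (inj₁ q) → f k q k+2≤n ; (inj₂ refl) → nlt })
      ...   | no nle | _ = inj₂ (λ k kl k+2≤n → case NP.m≤n⇒m<n∨m≡n (NP.≤-pred kl) of λ { (inj₁ q) → f k q k+2≤n ; (inj₂ refl) → ⊥-elim (nle k+2≤n) })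

    findDescent : ∀ u → NonNegQuotients u → Descent u
    findDescent u pos with invWindow n 1≤n u 0 ℤ.<? + 0
    ... | yes lt = descend (DescentS₀.i u pos lt , DescentS₀.nonneg′ u pos lt , DescentS₀.potential-drops u pos lt)
    ... | no nlt with SearchDescent.searchAdjacentDescent (invWindow n 1≤n u) n
    ...   | inj₁ (k , k+2≤n , lt) = descend (descent-sₖ u pos k k+2≤n lt)
    ...   | inj₂ f with + suc n ℤ.<? invWindow n 1≤n u (ℕ.pred n)
    ...     | yes lt = descend (descent-sₙ u pos lt)
    ...     | no nlt2 = atIdentity (SortedWindow.window-identity n 1≤n P nlt (λ k k+2≤n → f k (NP.<-trans (NP.n<1+n k) k+2≤n) k+2≤n) nlt2 s1 s2 s3)
      where
      P = invWindow n 1≤n u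
      sn : suc (ℕ.pred n) ≡ n
      sn = NP.suc-pred n ⦃ ℕ.>-nonZero 1≤n ⦄
      s1 : P 0 ≢ + 0
      s1 e = invWindow-res≢0 u 0 1≤n (trans (cong (resN n) e) refl)
      s2 : P (ℕ.pred n) ≢ + suc n
      s2 e = InvWindow.invWindow-+[n+1]-res≢0 n 1≤n u (ℕ.pred n) (subst (ℕ.pred n ℕ.<_) sn NP.≤-refl)
        (trans (cong (λ z → resN n (z + + suc n)) e) (proj₁ (divMod-unique (N n) (+ suc n + + suc n) 0 (+ 1) (s≤s z≤n) (trans (l (+ suc n)) (cong (λ M → + 0 + + 1 * M) (sym (Nℤ≡[n+1]+[n+1] n)))))))
        where
        l : ∀ (s : ℤ) → s + s ≡ + 0 + + 1 * (s + s)
        l = solve-∀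
      s3 : ∀ t → suc t ℕ.< n → P t ≢ P (suc t)
      s3 t lt e = InvWindow.invWindow-−-res≢0 n 1≤n u t (suc t) (NP.<-trans (NP.n<1+n t) lt) lt (λ q → NP.1+n≢n (sym q)) (trans (cong (λ z → resN n (z - P t)) (sym e)) (cong (resN n) (ZP.+-inverseʳ (P t))))

    potential-nonneg : ∀ u → NonNegQuotients u → + 0 ≤ potential u
    potential-nonneg u pos = ZP.+-mono-≤ (ℤ.+≤+ z≤n) (subst (_≤ quotientSum n (eval n u)) (sumTo-zero n (λ _ → + 0) (λ _ _ → refl)) (sumTo-mono-≤ n (λ _ → + 0) _ pos))

    shortWord : ∀ u → NonNegQuotients u → Σ[ v ∈ List (Fin (suc n)) ] SameElt n v u × (+ length v ≤ potential u)
    shortWord u nonneg = shortWord-fuel ℤ.∣ potential u ∣ u nonneg (ZP.≤-reflexive (sym (ZP.0≤i⇒+∣i∣≡i (potential-nonneg u nonneg))))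
      where
      shortWord-fuel : ∀ k u → NonNegQuotients u → potential u ≤ + k → Σ[ v ∈ List (Fin (suc n)) ] SameElt n v u × (+ length v ≤ potential u)
      shortWord-fuel k u nonneg bound with findDescent u nonneg
      ... | atIdentity isIdentity = [] , identity-word n 1≤n u isIdentity , potential-nonneg u nonneg
      shortWord-fuel zero u nonneg bound | descend (i , nonneg′ , drop) = ⊥-elim (ZP.<⇒≱ (+<+ (s≤s z≤n)) 1≤0)
        where
        1≤0 : + 1 ≤ + 0
        1≤0 = ZP.≤-trans (subst (_≤ potential u) (ZP.+-identityˡ (+ 1)) (subst (+ 0 + + 1 ≤_) drop (ZP.+-monoˡ-≤ (+ 1) (potential-nonneg (i ∷ u) nonneg′)))) bound
      shortWord-fuel (suc k) u nonneg bound | descend (i , nonneg′ , drop)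
        with shortWord-fuel k (i ∷ u) nonneg′ (+-cancelʳ-≤ (potential (i ∷ u)) (+ k) (+ 1) (subst₂ _≤_ (sym drop) (sym (+-suc-ℤ k)) bound))
      ... | v , v≡iu , |v|≤ = i ∷ v , (λ z → trans (cong (gen n i) (v≡iu z)) (gen-involutive n 1≤n i (eval n u z))) ,
            subst (+ suc (length v) ≤_) drop (subst (_≤ potential (i ∷ u) + + 1) (+-suc-ℤ (length v)) (ZP.+-monoˡ-≤ (+ 1) |v|≤))

  module _ (n : ℕ) (1≤n : 1 ℕ.≤ n) where
    minCosetRep-pos : ∀ (w : ℤ → ℤ) → IsMinCosetRep n w → ∀ j → InRange n j → + 0 < w (+ j)
    minCosetRep-pos w (0<w₁ , _) (suc zero) _ = 0<w₁
    minCosetRep-pos w minRep@(_ , increasing) (suc (suc j)) (_ , j+2≤n) =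
      ZP.<-trans (minCosetRep-pos w minRep (suc j) (s≤s z≤n , NP.≤-trans (NP.n≤1+n _) j+2≤n)) (increasing (suc j) (s≤s z≤n) j+2≤n)

    quoN-nonneg : ∀ x → + 0 < x → + 0 ≤ quoN n x
    quoN-nonneg (+ a) _ = +≤+ z≤n

    window-res≢0 : ∀ u i → InRange n i → resN n (eval n u (+ i)) ≢ 0
    window-res≢0 u i (1≤i , i≤n) r≡0 = Window.res≢res-neg n 1≤n u i i 1≤i i≤n 1≤i i≤n
      (trans r≡0 (sym (resN-cong-neg n (eval n u (+ i)) (+ 0) (trans r≡0 (sym (resN-small n 0 (s≤s z≤n)))))))

    ceil-formula : ∀ u → sumTo n (cW n (eval n u)) - + negW n (eval n u)
         ≡ sumTo n (λ i → ceilDiv (lamW n (eval n u) i) i) - sumTo n (λ i → ceilDiv (lamW n (eval n u) i) (2 ℕ.* i))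
    ceil-formula u = trans (sumTo-−countTo n (cW n w) (λ i → ⌊ σW n w i ℤ.<? + 0 ⌋)) (trans (sumTo-cong n _ _ termwise) (sym (sumTo-− n _ _)))
      where
      w = eval n u
      termwise : ∀ i → InRange n i → cW n w i - + (if ⌊ σW n w i ℤ.<? + 0 ⌋ then 1 else 0) ≡ ceilDiv (lamW n w i) i - ceilDiv (lamW n w i) (2 ℕ.* i)
      termwise (suc i) i∈ = sym (ceil-difference (σW n w) i (cW n w (suc i)) (σW-sign n w (suc i) (window-res≢0 u (suc i) i∈)))

    count0≤quotientSum : ∀ u → IsMinCosetRep n (eval n u) → Reduced n u → + count0 u ≤ quotientSum n (eval n u)
    count0≤quotientSum u minRep reduced = +-cancelʳ-≤ (+ count0 u) (quotientSum n w) (+ countOthers u) (begin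
      + count0 u + + countOthers u              ≡⟨ trans (cong +_ (length≡count0+countOthers u)) (ZP.pos-+ (count0 u) (countOthers u)) ⟨
      + length u                                ≤⟨ +≤+ (reduced v v≡u) ⟩
      + length v                                ≤⟨ |v|≤potential ⟩
      + inversions n 1≤n u + quotientSum n w    ≤⟨ ZP.+-monoˡ-≤ (quotientSum n w) (+≤+ (inversions≤countOthers n 1≤n u)) ⟩
      + countOthers u + quotientSum n w         ≡⟨ ZP.+-comm (+ countOthers u) (quotientSum n w) ⟩
      quotientSum n w + + countOthers u         ∎)
      where
      open ZP.≤-Reasoning
      w = eval n u
      nonneg : NonNegQuotients n 1≤n u
      nonneg j j∈ = quoN-nonneg (w (+ j)) (minCosetRep-pos w minRep j j∈)
      v = proj₁ (shortWord n 1≤n u nonneg)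
      v≡u = proj₁ (proj₂ (shortWord n 1≤n u nonneg))
      |v|≤potential = proj₂ (proj₂ (shortWord n 1≤n u nonneg))

open import Defs
open import Data.Nat using (ℕ; suc; _≤_; _*_)
open import Data.Integer using (ℤ; +_; _-_)
open import Data.Fin using (Fin)
open import Data.List using (List)
open import Data.Product using (_×_)
open import Relation.Binary.PropositionalEquality using (_≡_)

open AffineC using (count0≤quotientSum; quotientSum≤count0; sumC-neg≡quotientSum; ceil-formula)
import Data.Integer.Properties as ZP
open import Data.Product using (_,_)
open import Relation.Binary.PropositionalEquality using (trans; sym)

mainTheorem16 : (n : ℕ) → 1 ≤ n → (u : List (Fin (suc n))) →
    IsMinCosetRep n (eval n u) → Reduced n u →
    (+ count0 u ≡ sumTo n (cW n (eval n u)) - + negW n (eval n u))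
    × (sumTo n (cW n (eval n u)) - + negW n (eval n u)
    ≡ sumTo n (λ i → ceilDiv (lamW n (eval n u) i) i)
    - sumTo n (λ i → ceilDiv (lamW n (eval n u) i) (2 * i)))
mainTheorem16 n 1≤n u minRep reduced =
  trans (ZP.≤-antisym (count0≤quotientSum n 1≤n u minRep reduced) (quotientSum≤count0 n 1≤n u))
        (sym (sumC-neg≡quotientSum n (eval n u))) ,
  ceil-formula n 1≤n u
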